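{- Let $G$ be a graph with no even hole, no star cutset, and no sector wheel. Let $P=p_1\hbox{ - }\cdots\hbox{ - }p_k$ be a flat path of $G$. Let $W_1,W_2\subseteq V(G)$ satisfy $W_1\cap W_2=V(P)$, $W_1\cup W_2\subseteq N[P]$, and $G[W_1],G[W_2]$ chordal, and assume $N(p_1)\cap N(p_k)\subseteq W_1\cup W_2$. Then there exist $W_1'\supseteq W_1$ and $W_2'\supseteq W_2$ such that $W_1'\cap W_2'=V(P)$, $W_1'\cup W_2'=N[P]$, and $G[W_1'],G[W_2']$ are chordal.
   Context: A hole is an induced cycle with at least four vertices; even if it has an even number of vertices; a graph is chordal if it has no hole. A wheel $(H,w)$ consists of a hole $H$ and a vertex $w\notin V(H)$ with at least three neighbors in $V(H)$; a sector wheel is a wheel with $w$ adjacent to all of $V(H)$ or with $N(w)\cap V(H)$ inducing a path. $G$ has a star cutset if $G$ is connected and there exist a vertex $v$ and $C\subseteq N[v]$ with $v\in C$ such that $G\setminus C$ is disconnected. For a path $P$, $N[P]$ is the set of vertices in $P$ or with a neighbor in $P$. An induced path $(p_1,\dots,p_k)$ is flat if $p_2,\dots,p_{k-1}$ have degree $2$ in $G$. -}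

module Defs where

open import Data.Nat using (ℕ; zero; suc; _≤_; _<_)
open import Data.Nat.Divisibility using (_∣_)
open import Data.Fin using (Fin; toℕ; fromℕ) renaming (zero to fzero)
open import Data.Fin.Subset using (Subset; _∈_; _∉_; _⊆_; ∣_∣)
open import Data.Vec using (tabulate)
open import Data.Bool using (Bool; true; false)
open import Data.Product using (Σ; ∃; _×_; _,_)
open import Data.Sum using (_⊎_)
open import Function.Bundles using (_⇔_)
open import Function.Definitions using (Injective)
open import Relation.Binary.PropositionalEquality using (_≡_)
open import Relation.Nullary using (¬_)

record Graph (n : ℕ) : Set where
  field
    adj    : Fin n → Fin n → Bool
    sym    : ∀ u v → adj u v ≡ adj v u
    irrefl : ∀ v → adj v v ≡ false

module _ {n : ℕ} (G : Graph n) where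
  open Graph G

  Adj : Fin n → Fin n → Set
  Adj u v = adj u v ≡ true

  Nbhd : Fin n → Subset n
  Nbhd v = tabulate (adj v)

  degree : Fin n → ℕ
  degree v = ∣ Nbhd v ∣

  IsInducedPath : {k : ℕ} → (Fin k → Fin n) → Set
  IsInducedPath {k} f =
    Injective _≡_ _≡_ f ×
    (∀ i j → Adj (f i) (f j) ⇔ (suc (toℕ i) ≡ toℕ j ⊎ suc (toℕ j) ≡ toℕ i))

  CycAdj : (m : ℕ) → Fin m → Fin m → Set
  CycAdj m i j = suc (toℕ i) ≡ toℕ j ⊎ suc (toℕ j) ≡ toℕ i
               ⊎ (toℕ i ≡ 0 × suc (toℕ j) ≡ m) ⊎ (toℕ j ≡ 0 × suc (toℕ i) ≡ m)

  IsHole : {m : ℕ} → (Fin m → Fin n) → Set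
  IsHole {m} h = 4 ≤ m × Injective _≡_ _≡_ h × (∀ i j → Adj (h i) (h j) ⇔ CycAdj m i j)

  Hole : Set
  Hole = Σ ℕ λ m → Σ (Fin m → Fin n) λ h → IsHole h

  EvenHole : Set
  EvenHole = Σ ℕ λ m → Σ (Fin m → Fin n) λ h → IsHole h × 2 ∣ m

  ChordalOn : Subset n → Set
  ChordalOn S = ¬ (Σ ℕ λ m → Σ (Fin m → Fin n) λ h → IsHole h × (∀ i → h i ∈ S))

  InducesPath : (Fin n → Set) → Set
  InducesPath S = Σ ℕ λ k → Σ (Fin k → Fin n) λ f →
    IsInducedPath f × (∀ v → S v ⇔ (∃ λ i → f i ≡ v))

  IsWheel : {m : ℕ} → (Fin m → Fin n) → Fin n → Set
  IsWheel {m} h w = IsHole h × (¬ ∃ λ i → h i ≡ w)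
                  × 3 ≤ ∣ tabulate {n = m} (λ i → adj w (h i)) ∣

  IsSectorWheel : {m : ℕ} → (Fin m → Fin n) → Fin n → Set
  IsSectorWheel {m} h w = IsWheel h w ×
    ((∀ i → Adj w (h i)) ⊎ InducesPath (λ v → Adj w v × ∃ λ i → h i ≡ v))

  HasSectorWheel : Set
  HasSectorWheel = Σ ℕ λ m → Σ (Fin m → Fin n) λ h → Σ (Fin n) λ w → IsSectorWheel h w

  data Walk (S : Fin n → Set) : Fin n → Fin n → Set where
    here : ∀ {u} → S u → Walk S u u
    step : ∀ {u v w} → S u → Adj u v → Walk S v w → Walk S u w

  Connected : Set
  Connected = ∀ u v → Walk (λ _ → Data.Unit.⊤) u v
    where import Data.Unit

  HasStarCutset : Set
  HasStarCutset = Connected × Σ (Fin n) λ v → Σ (Subset n) λ C →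
    v ∈ C × (∀ x → x ∈ C → x ≡ v ⊎ Adj v x) ×
    (Σ (Fin n) λ a → Σ (Fin n) λ b → a ∉ C × b ∉ C × ¬ Walk (λ x → x ∉ C) a b)

  -- path p_1 - ... - p_k with k = suc m given by p : Fin (suc m) → V(G)
  IsFlatPath : {m : ℕ} → (Fin (suc m) → Fin n) → Set
  IsFlatPath {m} p = IsInducedPath p ×
    (∀ i → 0 < toℕ i → toℕ i < m → degree (p i) ≡ 2)

  VP : {k : ℕ} → (Fin k → Fin n) → Fin n → Set
  VP p v = ∃ λ i → p i ≡ v

  NP : {k : ℕ} → (Fin k → Fin n) → Fin n → Set
  NP p v = VP p v ⊎ ∃ λ i → Adj (p i) v

module Submission where

-- A vertex of N[P] ∖ V(P) sees only the ends of P, the inner vertices of a flat path having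
-- degree 2; an unassigned one sees exactly one end, so it lies in A = N(p₁) ∖ (N(pₖ) ∪ V(P))
-- or in B = N(pₖ) ∖ (N(p₁) ∪ V(P)).  A hole inside N[P] without A–B edges cannot meet A:
-- according as it contains p₁, an inner vertex of P (and hence p₁), only pₖ, or no vertex of P,
-- it yields an A–B edge or a sector wheel centred at p₁.  Reversing P, it cannot meet B either,
-- so a chordal set stays chordal when vertices of A ∪ B without A–B edges between them are
-- added.  A vertex of B has at most one neighbour in A and vice versa (else a 4-hole or a sector
-- wheel), which makes the assignment "an A-vertex joins W₁ unless it has a B-neighbour in W₁,
-- a B-vertex joins W₁ iff it has an A-neighbour in W₂" free of A–B edges on both sides.

open import Defs
open import Data.Nat using (ℕ; suc)
open import Data.Fin using (Fin; fromℕ) renaming (zero to fzero)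
open import Data.Fin.Subset using (Subset; _∈_; _⊆_)
open import Data.Product using (Σ; _×_)
open import Data.Sum using (_⊎_)
open import Function.Bundles using (_⇔_)
open import Relation.Nullary using (¬_)

open import Data.Nat as ℕ using (zero; _+_; _∸_; _≤_; _<_; z≤n; s≤s)
open import Data.Nat.Divisibility using (divides)
import Data.Nat.Properties as ℕₚ
open import Data.Fin as Fin using (toℕ; fromℕ<; opposite) renaming (suc to fsuc)
open import Data.Fin.Properties
  using (toℕ-injective; toℕ<n; toℕ-fromℕ<; toℕ-fromℕ; toℕ≤pred[n]; any?; all?; ¬∀⟶∃¬; opposite-prop; opposite-involutive)
open import Data.Fin.Subset using (∣_∣; _-_; _∉_)
open import Data.Fin.Subset.Properties using (x∈p∧x≢y⇒x∈p-y; x∈p⇒∣p-x∣<∣p∣; _∈?_)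
open import Data.Vec using (tabulate)
open import Data.Vec.Properties using (lookup∘tabulate; []=⇒lookup; lookup⇒[]=)
open import Data.Bool as Bool using (Bool; true)
open import Data.Product using (∃; _,_; proj₁; proj₂; uncurry)
open import Data.Sum using (inj₁; inj₂; [_,_])
open import Data.Empty using (⊥; ⊥-elim)
open import Function using (_∘_; flip)
open import Data.Vec.Functional using ([]; _∷_)
open import Function.Bundles using (mk⇔; Equivalence)
open Equivalence using (to; from)
open import Relation.Binary.PropositionalEquality hiding ([_])
open import Relation.Nullary using (Dec; yes; no; does)
open import Relation.Nullary.Decidable using (dec-true; decidable-stable; _×-dec_; _⊎-dec_; ¬?)
open import Relation.Unary using (Decidable)

private variable
  n k : ℕ

∈-tabulate⁺ : (f : Fin n → Bool) {v : Fin n} → f v ≡ true → v ∈ tabulate f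
∈-tabulate⁺ f {v} fv = lookup⇒[]= v (tabulate f) (trans (lookup∘tabulate f v) fv)

∈-tabulate⁻ : (f : Fin n → Bool) {v : Fin n} → v ∈ tabulate f → f v ≡ true
∈-tabulate⁻ f {v} v∈ = trans (sym (lookup∘tabulate f v)) ([]=⇒lookup v∈)

subsetOf : {P : Fin n → Set} → Decidable P → Subset n
subsetOf P? = tabulate (does ∘ P?)

∈-subsetOf⁺ : {P : Fin n → Set} (P? : Decidable P) {v : Fin n} → P v → v ∈ subsetOf P?
∈-subsetOf⁺ P? {v} Pv = ∈-tabulate⁺ (does ∘ P?) (dec-true (P? v) Pv)

∈-subsetOf⁻ : {P : Fin n → Set} (P? : Decidable P) {v : Fin n} → v ∈ subsetOf P? → P v
∈-subsetOf⁻ P? {v} v∈ = witness (P? v) (∈-tabulate⁻ (does ∘ P?) v∈)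
  where
  witness : ∀ {A : Set} (A? : Dec A) → does A? ≡ true → A
  witness (yes a) _ = a

distinct³⇒3≤∣p∣ : {s : Subset n} {x y z : Fin n} → x ∈ s → y ∈ s → z ∈ s →
        x ≢ y → x ≢ z → y ≢ z → 3 ≤ ∣ s ∣
distinct³⇒3≤∣p∣ {s = s} {x} {y} {z} x∈ y∈ z∈ x≢y x≢z y≢z =
  ℕₚ.≤-trans (s≤s (ℕₚ.≤-trans (s≤s (ℕₚ.≤-trans (s≤s z≤n) ∣s-x-y-z∣<)) ∣s-x-y∣<)) ∣s-x∣<
  where
  y∈s-x : y ∈ s - x
  y∈s-x = x∈p∧x≢y⇒x∈p-y y∈ (x≢y ∘ sym)
  z∈s-x-y : z ∈ s - x - y
  z∈s-x-y = x∈p∧x≢y⇒x∈p-y (x∈p∧x≢y⇒x∈p-y z∈ (x≢z ∘ sym)) (y≢z ∘ sym)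
  ∣s-x∣< : ∣ s - x ∣ < ∣ s ∣
  ∣s-x∣< = x∈p⇒∣p-x∣<∣p∣ x∈
  ∣s-x-y∣< : ∣ s - x - y ∣ < ∣ s - x ∣
  ∣s-x-y∣< = x∈p⇒∣p-x∣<∣p∣ y∈s-x
  ∣s-x-y-z∣< : ∣ s - x - y - z ∣ < ∣ s - x - y ∣
  ∣s-x-y-z∣< = x∈p⇒∣p-x∣<∣p∣ z∈s-x-y

module _ {P : ℕ → Set} (P? : Decidable P) where

  last-failure-below : ∀ {j} → ¬ P 0 → P j → ∃ λ s → s < j × ¬ P s × (∀ i → s < i → i ≤ j → P i)
  last-failure-below {zero}  ¬P0 P0 = ⊥-elim (¬P0 P0)
  last-failure-below {suc j} ¬P0 Pj+1 with P? j
  ... | no ¬Pj = j , ℕₚ.n<1+n j , ¬Pj , λ i j<i i≤ → subst P (ℕₚ.≤-antisym j<i i≤) Pj+1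
  ... | yes Pj with last-failure-below ¬P0 Pj
  ...   | s , s<j , ¬Ps , run = s , ℕₚ.m<n⇒m<1+n s<j , ¬Ps , extend
    where
    extend : ∀ i → s < i → i ≤ suc j → P i
    extend i s<i i≤ with ℕₚ.m≤n⇒m<n∨m≡n i≤
    ... | inj₁ i<  = run i s<i (ℕₚ.≤-pred i<)
    ... | inj₂ refl = Pj+1

  first-failure-above : ∀ {j} k → j ≤ k → P j → (∀ i → j ≤ i → i ≤ k → P i) ⊎
    ∃ λ t → j < t × t ≤ k × ¬ P t × (∀ i → j ≤ i → i < t → P i)
  first-failure-above {j} k j≤k Pj with j ℕ.≟ k
  first-failure-above {j} k j≤k Pj | yes refl = inj₁ λ i j≤i i≤j → subst P (ℕₚ.≤-antisym j≤i i≤j) Pj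
  first-failure-above {j} zero z≤n Pj | no 0≢0 = ⊥-elim (0≢0 refl)
  first-failure-above {j} (suc k) j≤k Pj | no j≢k with first-failure-above k (ℕₚ.≤-pred (ℕₚ.≤∧≢⇒< j≤k j≢k)) Pj
  ... | inj₂ (t , j<t , t≤k , ¬Pt , run) = inj₂ (t , j<t , ℕₚ.m≤n⇒m≤1+n t≤k , ¬Pt , run)
  ... | inj₁ run with P? (suc k)
  ...   | no ¬Pk = inj₂ (suc k , ℕₚ.≤∧≢⇒< j≤k j≢k , ℕₚ.≤-refl , ¬Pk , λ i j≤i i< → run i j≤i (ℕₚ.≤-pred i<))
  ...   | yes Pk = inj₁ extend
    where
    extend : ∀ i → j ≤ i → i ≤ suc k → P i
    extend i j≤i i≤ with ℕₚ.m≤n⇒m<n∨m≡n i≤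
    ... | inj₁ i<   = run i j≤i (ℕₚ.≤-pred i<)
    ... | inj₂ refl = Pk

-- Cyclic order

-- CycAdj G (suc k) i j unfolds to CycAdjℕ k (toℕ i) (toℕ j).
CycAdjℕ : ℕ → ℕ → ℕ → Set
CycAdjℕ k a b = suc a ≡ b ⊎ suc b ≡ a ⊎ (a ≡ 0 × suc b ≡ suc k) ⊎ (b ≡ 0 × suc a ≡ suc k)

CycAdjℕ-sym : ∀ {a b} → CycAdjℕ k a b → CycAdjℕ k b a
CycAdjℕ-sym (inj₁ e)               = inj₂ (inj₁ e)
CycAdjℕ-sym (inj₂ (inj₁ e))        = inj₁ e
CycAdjℕ-sym (inj₂ (inj₂ (inj₁ e))) = inj₂ (inj₂ (inj₂ e))
CycAdjℕ-sym (inj₂ (inj₂ (inj₂ e))) = inj₂ (inj₂ (inj₁ e))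

CycAdjℕ-0 : ∀ {b} → 3 ≤ k → CycAdjℕ k 0 b → b ≡ 1 ⊎ b ≡ k
CycAdjℕ-0 _ (inj₁ e)                            = inj₁ (sym e)
CycAdjℕ-0 _ (inj₂ (inj₂ (inj₁ (_ , e))))        = inj₂ (ℕₚ.suc-injective e)
CycAdjℕ-0 {suc _} _ (inj₂ (inj₂ (inj₂ (_ , ()))))

¬CycAdjℕ-1-k : 3 ≤ k → ¬ CycAdjℕ k 1 k
¬CycAdjℕ-1-k 3≤k (inj₁ e)                = ℕₚ.<-irrefl e 3≤k
¬CycAdjℕ-1-k {suc _} _ (inj₂ (inj₁ ()))
¬CycAdjℕ-1-k {suc _} _ (inj₂ (inj₂ (inj₂ (() , _))))

-- The successor of ℤ/(1 + k) on the representatives 0, …, k.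
sucMod : ℕ → ℕ → ℕ
sucMod k a with a ℕ.≟ k
... | yes _ = 0
... | no  _ = suc a

sucMod-≤ : ∀ a → a ≤ k → sucMod k a ≤ k
sucMod-≤ {k} a a≤k with a ℕ.≟ k
... | yes _   = z≤n
... | no  a≢k = ℕₚ.≤∧≢⇒< a≤k a≢k

sucMod-injective : ∀ {a b} → a ≤ k → b ≤ k → sucMod k a ≡ sucMod k b → a ≡ b
sucMod-injective {k} {a} {b} _ _ e with a ℕ.≟ k | b ℕ.≟ k
... | yes a≡k | yes b≡k = trans a≡k (sym b≡k)
... | no  _   | no  _   = ℕₚ.suc-injective e

sucMod-k : sucMod k k ≡ 0
sucMod-k {k} with k ℕ.≟ k
... | yes _  = refl
... | no k≢k = ⊥-elim (k≢k refl)

sucMod-≢ : ∀ {a} → a ≢ k → sucMod k a ≡ suc a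
sucMod-≢ {k} {a} a≢k with a ℕ.≟ k
... | yes a≡k = ⊥-elim (a≢k a≡k)
... | no  _   = refl

predMod : ℕ → ℕ → ℕ
predMod k zero    = k
predMod k (suc a) = a

predMod-≤ : ∀ a → a ≤ k → predMod k a ≤ k
predMod-≤ zero    _   = ℕₚ.≤-refl
predMod-≤ (suc a) a<k = ℕₚ.<⇒≤ a<k

sucMod-predMod : ∀ a → a ≤ k → sucMod k (predMod k a) ≡ a
sucMod-predMod zero    _   = sucMod-k
sucMod-predMod (suc a) a<k = sucMod-≢ (λ a≡k → ℕₚ.<-irrefl a≡k a<k)

CycAdjℕ⇒sucMod : ∀ {a b} → a ≤ k → b ≤ k → CycAdjℕ k a b → b ≡ sucMod k a ⊎ a ≡ sucMod k b
CycAdjℕ⇒sucMod _ b≤k (inj₁ refl) =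
  inj₁ (sym (sucMod-≢ λ a≡k → ℕₚ.<-irrefl a≡k b≤k))
CycAdjℕ⇒sucMod a≤k _ (inj₂ (inj₁ refl)) =
  inj₂ (sym (sucMod-≢ λ b≡k → ℕₚ.<-irrefl b≡k a≤k))
CycAdjℕ⇒sucMod _ _ (inj₂ (inj₂ (inj₁ (refl , refl)))) = inj₂ (sym sucMod-k)
CycAdjℕ⇒sucMod _ _ (inj₂ (inj₂ (inj₂ (refl , refl)))) = inj₁ (sym sucMod-k)

sucMod⇒CycAdjℕ : ∀ {a b} → b ≡ sucMod k a → CycAdjℕ k a b
sucMod⇒CycAdjℕ {k} {a} b≡ with a ℕ.≟ k
... | yes a≡k = inj₂ (inj₂ (inj₂ (b≡ , cong suc a≡k)))
... | no  _   = inj₁ (sym b≡)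

sucMod-CycAdjℕ⁻ : ∀ {a b} → a ≤ k → b ≤ k → CycAdjℕ k (sucMod k a) (sucMod k b) → CycAdjℕ k a b
sucMod-CycAdjℕ⁻ a≤k b≤k c with CycAdjℕ⇒sucMod (sucMod-≤ _ a≤k) (sucMod-≤ _ b≤k) c
... | inj₁ e = sucMod⇒CycAdjℕ (sucMod-injective b≤k (sucMod-≤ _ a≤k) e)
... | inj₂ e = CycAdjℕ-sym (sucMod⇒CycAdjℕ (sucMod-injective a≤k (sucMod-≤ _ b≤k) e))

sucMod-CycAdjℕ⁺ : ∀ {a b} → a ≤ k → b ≤ k → CycAdjℕ k a b → CycAdjℕ k (sucMod k a) (sucMod k b)
sucMod-CycAdjℕ⁺ {k} a≤k b≤k c with CycAdjℕ⇒sucMod a≤k b≤k c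
... | inj₁ e = sucMod⇒CycAdjℕ (cong (sucMod k) e)
... | inj₂ e = CycAdjℕ-sym (sucMod⇒CycAdjℕ (cong (sucMod k) e))

fromℕ≤ : ∀ {a} → a ≤ k → Fin (suc k)
fromℕ≤ a≤k = fromℕ< (s≤s a≤k)

toℕ-fromℕ≤ : ∀ {a} (a≤k : a ≤ k) → toℕ (fromℕ≤ a≤k) ≡ a
toℕ-fromℕ≤ a≤k = toℕ-fromℕ< (s≤s a≤k)

rotate : Fin (suc k) → Fin (suc k)
rotate i = fromℕ≤ (sucMod-≤ (toℕ i) (toℕ≤pred[n] i))

toℕ-rotate : (i : Fin (suc k)) → toℕ (rotate i) ≡ sucMod k (toℕ i)
toℕ-rotate i = toℕ-fromℕ≤ (sucMod-≤ (toℕ i) (toℕ≤pred[n] i))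

unrotate : Fin (suc k) → Fin (suc k)
unrotate i = fromℕ≤ (predMod-≤ (toℕ i) (toℕ≤pred[n] i))

rotate-unrotate : (i : Fin (suc k)) → rotate (unrotate i) ≡ i
rotate-unrotate {k} i = toℕ-injective (begin
  toℕ (rotate (unrotate i))         ≡⟨ toℕ-rotate (unrotate i) ⟩
  sucMod k (toℕ (unrotate i))       ≡⟨ cong (sucMod k) (toℕ-fromℕ≤ (predMod-≤ (toℕ i) (toℕ≤pred[n] i))) ⟩
  sucMod k (predMod k (toℕ i))      ≡⟨ sucMod-predMod (toℕ i) (toℕ≤pred[n] i) ⟩
  toℕ i                             ∎)
  where open ≡-Reasoning

-- Holes, induced paths and wheels

module _ {n : ℕ} (G : Graph n) where
  open Graph G using (adj; irrefl) renaming (sym to adj-sym)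

  Adj-sym : ∀ {u v} → Adj G u v → Adj G v u
  Adj-sym {u} {v} uv = trans (sym (adj-sym u v)) uv

  Adj-irrefl : ∀ {v} → ¬ Adj G v v
  Adj-irrefl {v} vv with trans (sym (irrefl v)) vv
  ... | ()

  Im : ∀ {m} → (Fin m → Fin n) → Fin n → Set
  Im h v = ∃ λ i → h i ≡ v

  rotate-isHole : {h : Fin (suc k) → Fin n} → IsHole G h → IsHole G (h ∘ rotate)
  rotate-isHole {k} {h} (4≤ , h-inj , h-adj) = 4≤ , inj , λ i j → mk⇔ (⇒ i j) (⇐ i j)
    where
    inj : ∀ {i j} → h (rotate i) ≡ h (rotate j) → i ≡ j
    inj {i} {j} e = toℕ-injective (sucMod-injective (toℕ≤pred[n] i) (toℕ≤pred[n] j)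
      (trans (sym (toℕ-rotate i)) (trans (cong toℕ (h-inj e)) (toℕ-rotate j))))
    ⇒ : ∀ i j → Adj G (h (rotate i)) (h (rotate j)) → CycAdjℕ k (toℕ i) (toℕ j)
    ⇒ i j a = sucMod-CycAdjℕ⁻ (toℕ≤pred[n] i) (toℕ≤pred[n] j)
      (subst₂ (CycAdjℕ k) (toℕ-rotate i) (toℕ-rotate j) (to (h-adj (rotate i) (rotate j)) a))
    ⇐ : ∀ i j → CycAdjℕ k (toℕ i) (toℕ j) → Adj G (h (rotate i)) (h (rotate j))
    ⇐ i j c = from (h-adj (rotate i) (rotate j))
      (subst₂ (CycAdjℕ k) (sym (toℕ-rotate i)) (sym (toℕ-rotate j))
        (sucMod-CycAdjℕ⁺ (toℕ≤pred[n] i) (toℕ≤pred[n] j) c))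

  rotate-hole-at : ∀ {k} {h : Fin (suc k) → Fin n} → IsHole G h → (l : Fin (suc k)) →
    Σ (Fin (suc k) → Fin n) λ h′ → IsHole G h′ × h′ fzero ≡ h l × (∀ v → Im h′ v ⇔ Im h v)
  rotate-hole-at hole l = rotate-times (toℕ l) hole l refl
    where
    rotate-times : ∀ t {k} {h : Fin (suc k) → Fin n} → IsHole G h → (l : Fin (suc k)) → toℕ l ≡ t →
      Σ (Fin (suc k) → Fin n) λ h′ → IsHole G h′ × h′ fzero ≡ h l × (∀ v → Im h′ v ⇔ Im h v)
    rotate-times zero {h = h} hole l l≡0 with toℕ-injective {i = l} {j = fzero} l≡0
    ... | refl = h , hole , refl , λ v → mk⇔ (λ x → x) (λ x → x)
    rotate-times (suc t) {k} {h} hole l l≡ with rotate-times t (rotate-isHole hole) (unrotate l)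
             (trans (toℕ-fromℕ≤ (predMod-≤ (toℕ l) (toℕ≤pred[n] l))) (cong (predMod k) l≡))
    ... | h′ , hole′ , h′0 , same = h′ , hole′ , trans h′0 (cong h (rotate-unrotate l)) ,
      λ v → mk⇔ (λ x → let (i , hi) = to (same v) x in rotate i , hi)
                (λ { (i , hi) → from (same v) (unrotate i , trans (cong h (rotate-unrotate i)) hi) })

  -- A hole of length 1 + k read as a function on ℕ; its values beyond k are junk.
  module Indexed {k} {h : Fin (suc k) → Fin n} (hole : IsHole G h) where

    3≤k : 3 ≤ k
    3≤k = ℕₚ.≤-pred (proj₁ hole)

    1≤k : 1 ≤ k
    1≤k = ℕₚ.<-trans (s≤s z≤n) 3≤k

    at : ℕ → Fin n
    at a with a ℕ.<? suc k
    ... | yes a<  = h (fromℕ< a<)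
    ... | no  _   = h fzero

    at-fromℕ≤ : ∀ {a} (a≤k : a ≤ k) → at a ≡ h (fromℕ≤ a≤k)
    at-fromℕ≤ {a} a≤k with a ℕ.<? suc k
    ... | yes a<  = cong h (toℕ-injective (trans (toℕ-fromℕ< a<) (sym (toℕ-fromℕ≤ a≤k))))
    ... | no  a≮ = ⊥-elim (a≮ (s≤s a≤k))

    at-toℕ : ∀ i → at (toℕ i) ≡ h i
    at-toℕ i = trans (at-fromℕ≤ (toℕ≤pred[n] i)) (cong h (toℕ-injective (toℕ-fromℕ≤ (toℕ≤pred[n] i))))

    adj⇒CycAdjℕ : ∀ {a b} → a ≤ k → b ≤ k → Adj G (at a) (at b) → CycAdjℕ k a b
    adj⇒CycAdjℕ a≤ b≤ ab = subst₂ (CycAdjℕ k) (toℕ-fromℕ≤ a≤) (toℕ-fromℕ≤ b≤)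
      (to (proj₂ (proj₂ hole) (fromℕ≤ a≤) (fromℕ≤ b≤)) (subst₂ (Adj G) (at-fromℕ≤ a≤) (at-fromℕ≤ b≤) ab))

    CycAdjℕ⇒adj : ∀ {a b} → a ≤ k → b ≤ k → CycAdjℕ k a b → Adj G (at a) (at b)
    CycAdjℕ⇒adj a≤ b≤ c = subst₂ (Adj G) (sym (at-fromℕ≤ a≤)) (sym (at-fromℕ≤ b≤))
      (from (proj₂ (proj₂ hole) (fromℕ≤ a≤) (fromℕ≤ b≤))
        (subst₂ (CycAdjℕ k) (sym (toℕ-fromℕ≤ a≤)) (sym (toℕ-fromℕ≤ b≤)) c))

    at-injective : ∀ {a b} → a ≤ k → b ≤ k → at a ≡ at b → a ≡ b
    at-injective a≤ b≤ e = trans (sym (toℕ-fromℕ≤ a≤)) (trans (cong toℕ (proj₁ (proj₂ hole)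
      (trans (sym (at-fromℕ≤ a≤)) (trans e (at-fromℕ≤ b≤))))) (toℕ-fromℕ≤ b≤))

    Im-at : ∀ {a} → a ≤ k → Im h (at a)
    Im-at a≤ = fromℕ≤ a≤ , sym (at-fromℕ≤ a≤)

    Im⇒at : ∀ {v} → Im h v → ∃ λ a → a ≤ k × at a ≡ v
    Im⇒at (i , hi) = toℕ i , toℕ≤pred[n] i , trans (at-toℕ i) hi

    -- The disjunction says that the window s, …, s + L - 1 does not contain both 0 and k.
    segment-isInducedPath : ∀ s L → s + L ≤ suc k → 1 ≤ s ⊎ s + L ≤ k →
      IsInducedPath G {L} (λ i → at (s + toℕ i))
    segment-isInducedPath s L s+L≤ avoids = inj , λ i j → mk⇔ (⇒ i j) (⇐ i j)
      where
      ≤k : ∀ (i : Fin L) → s + toℕ i ≤ k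
      ≤k i = ℕₚ.≤-pred (ℕₚ.≤-trans (ℕₚ.+-monoʳ-< s (toℕ<n i)) s+L≤)
      inj : ∀ {i j} → at (s + toℕ i) ≡ at (s + toℕ j) → i ≡ j
      inj {i} {j} e = toℕ-injective (ℕₚ.+-cancelˡ-≡ s _ _ (at-injective (≤k i) (≤k j) e))
      no-wrap : ∀ s′ → 1 ≤ s′ ⊎ s′ + L ≤ k → ∀ (i j : Fin L) → s′ + toℕ i ≡ 0 → suc (s′ + toℕ j) ≡ suc k → ⊥
      no-wrap zero    (inj₂ L≤k) i j _ e =
        ℕₚ.<-irrefl (ℕₚ.suc-injective e) (ℕₚ.<-≤-trans (toℕ<n j) L≤k)
      no-wrap (suc _) _          i j () _
      ⇒ : ∀ i j → Adj G (at (s + toℕ i)) (at (s + toℕ j)) → suc (toℕ i) ≡ toℕ j ⊎ suc (toℕ j) ≡ toℕ i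
      ⇒ i j a with adj⇒CycAdjℕ (≤k i) (≤k j) a
      ... | inj₁ e                      = inj₁ (ℕₚ.+-cancelˡ-≡ s _ _ (trans (ℕₚ.+-suc s _) e))
      ... | inj₂ (inj₁ e)               = inj₂ (ℕₚ.+-cancelˡ-≡ s _ _ (trans (ℕₚ.+-suc s _) e))
      ... | inj₂ (inj₂ (inj₁ (e₀ , e))) = ⊥-elim (no-wrap s avoids i j e₀ e)
      ... | inj₂ (inj₂ (inj₂ (e₀ , e))) = ⊥-elim (no-wrap s avoids j i e₀ e)
      ⇐ : ∀ i j → suc (toℕ i) ≡ toℕ j ⊎ suc (toℕ j) ≡ toℕ i → Adj G (at (s + toℕ i)) (at (s + toℕ j))
      ⇐ i j (inj₁ e) = CycAdjℕ⇒adj (≤k i) (≤k j) (inj₁ (trans (sym (ℕₚ.+-suc s _)) (cong (s +_) e)))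
      ⇐ i j (inj₂ e) = CycAdjℕ⇒adj (≤k i) (≤k j) (inj₂ (inj₁ (trans (sym (ℕₚ.+-suc s _)) (cong (s +_) e))))

  []-isInducedPath : ∀ v → IsInducedPath G (v ∷ [])
  []-isInducedPath v = (λ {i} {j} _ → unique i j) ,
    λ { fzero fzero → mk⇔ (⊥-elim ∘ Adj-irrefl) (⊥-elim ∘ ¬consecutive) }
    where
    unique : ∀ (i j : Fin 1) → i ≡ j
    unique fzero fzero = refl
    ¬consecutive : ¬ (1 ≡ 0 ⊎ 1 ≡ 0)
    ¬consecutive (inj₁ ())
    ¬consecutive (inj₂ ())

  ∷-isInducedPath : ∀ {L} {f : Fin L → Fin n} → IsInducedPath G f → ∀ w → (∀ i → f i ≢ w) →
    (∀ i → Adj G w (f i) ⇔ toℕ i ≡ 0) → IsInducedPath G (w ∷ f)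
  ∷-isInducedPath {f = f} (f-inj , f-adj) w w∉f w-adj = inj , λ i j → mk⇔ (⇒ i j) (⇐ i j)
    where
    inj : ∀ {i j} → (w ∷ f) i ≡ (w ∷ f) j → i ≡ j
    inj {fzero}  {fzero}  _ = refl
    inj {fzero}  {fsuc j} e = ⊥-elim (w∉f j (sym e))
    inj {fsuc i} {fzero}  e = ⊥-elim (w∉f i e)
    inj {fsuc i} {fsuc j} e = cong fsuc (f-inj e)
    ⇒ : ∀ i j → Adj G ((w ∷ f) i) ((w ∷ f) j) → suc (toℕ i) ≡ toℕ j ⊎ suc (toℕ j) ≡ toℕ i
    ⇒ fzero    fzero    a = ⊥-elim (Adj-irrefl a)
    ⇒ fzero    (fsuc j) a = inj₁ (cong suc (sym (to (w-adj j) a)))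
    ⇒ (fsuc i) fzero    a = inj₂ (cong suc (sym (to (w-adj i) (Adj-sym a))))
    ⇒ (fsuc i) (fsuc j) a with to (f-adj i j) a
    ... | inj₁ e = inj₁ (cong suc e)
    ... | inj₂ e = inj₂ (cong suc e)
    ⇐ : ∀ i j → suc (toℕ i) ≡ toℕ j ⊎ suc (toℕ j) ≡ toℕ i → Adj G ((w ∷ f) i) ((w ∷ f) j)
    ⇐ fzero    (fsuc j) (inj₁ e) = from (w-adj j) (sym (ℕₚ.suc-injective e))
    ⇐ (fsuc i) fzero    (inj₂ e) = Adj-sym (from (w-adj i) (sym (ℕₚ.suc-injective e)))
    ⇐ (fsuc i) (fsuc j) (inj₁ e) = from (f-adj i j) (inj₁ (ℕₚ.suc-injective e))
    ⇐ (fsuc i) (fsuc j) (inj₂ e) = from (f-adj i j) (inj₂ (ℕₚ.suc-injective e))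

  ∷-isHole : ∀ {L} {f : Fin L → Fin n} → 3 ≤ L → IsInducedPath G f → ∀ w → (∀ i → f i ≢ w) →
    (∀ i → Adj G w (f i) ⇔ (toℕ i ≡ 0 ⊎ suc (toℕ i) ≡ L)) → IsHole G (w ∷ f)
  ∷-isHole {L} {f} 3≤L (f-inj , f-adj) w w∉f w-adj = s≤s 3≤L , inj , λ i j → mk⇔ (⇒ i j) (⇐ i j)
    where
    inj : ∀ {i j} → (w ∷ f) i ≡ (w ∷ f) j → i ≡ j
    inj {fzero}  {fzero}  _ = refl
    inj {fzero}  {fsuc j} e = ⊥-elim (w∉f j (sym e))
    inj {fsuc i} {fzero}  e = ⊥-elim (w∉f i e)
    inj {fsuc i} {fsuc j} e = cong fsuc (f-inj e)
    L≢0 : L ≢ 0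
    L≢0 L≡0 = ℕₚ.<-irrefl (sym L≡0) (ℕₚ.<-trans (s≤s z≤n) 3≤L)
    apex⇒ : ∀ j → Adj G w (f j) → CycAdjℕ L 0 (suc (toℕ j))
    apex⇒ j a with to (w-adj j) a
    ... | inj₁ e = inj₁ (cong suc (sym e))
    ... | inj₂ e = inj₂ (inj₂ (inj₁ (refl , cong suc e)))
    apex⇐ : ∀ j → CycAdjℕ L 0 (suc (toℕ j)) → Adj G w (f j)
    apex⇐ j (inj₁ e)                       = from (w-adj j) (inj₁ (sym (ℕₚ.suc-injective e)))
    apex⇐ j (inj₂ (inj₂ (inj₁ (_ , e))))   = from (w-adj j) (inj₂ (ℕₚ.suc-injective e))
    ⇒ : ∀ i j → Adj G ((w ∷ f) i) ((w ∷ f) j) → CycAdjℕ L (toℕ i) (toℕ j)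
    ⇒ fzero    fzero    a = ⊥-elim (Adj-irrefl a)
    ⇒ fzero    (fsuc j) a = apex⇒ j a
    ⇒ (fsuc i) fzero    a = CycAdjℕ-sym (apex⇒ i (Adj-sym a))
    ⇒ (fsuc i) (fsuc j) a with to (f-adj i j) a
    ... | inj₁ e = inj₁ (cong suc e)
    ... | inj₂ e = inj₂ (inj₁ (cong suc e))
    ⇐ : ∀ i j → CycAdjℕ L (toℕ i) (toℕ j) → Adj G ((w ∷ f) i) ((w ∷ f) j)
    ⇐ fzero    fzero    (inj₂ (inj₂ (inj₁ (_ , e)))) = ⊥-elim (L≢0 (sym (ℕₚ.suc-injective e)))
    ⇐ fzero    fzero    (inj₂ (inj₂ (inj₂ (_ , e)))) = ⊥-elim (L≢0 (sym (ℕₚ.suc-injective e)))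
    ⇐ fzero    (fsuc j) c = apex⇐ j c
    ⇐ (fsuc i) fzero    c = Adj-sym (apex⇐ i (CycAdjℕ-sym c))
    ⇐ (fsuc i) (fsuc j) (inj₁ e)        = from (f-adj i j) (inj₁ (ℕₚ.suc-injective e))
    ⇐ (fsuc i) (fsuc j) (inj₂ (inj₁ e)) = from (f-adj i j) (inj₂ (ℕₚ.suc-injective e))
    ⇐ (fsuc i) (fsuc j) (inj₂ (inj₂ (inj₁ (() , _))))
    ⇐ (fsuc i) (fsuc j) (inj₂ (inj₂ (inj₂ (() , _))))

  sectorWheel : ∀ {m} {Q : Fin m → Fin n} {z} → IsHole G Q → (∀ i → Q i ≢ z) →
    (i₁ i₂ i₃ : Fin m) → i₁ ≢ i₂ → i₁ ≢ i₃ → i₂ ≢ i₃ →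
    Adj G z (Q i₁) → Adj G z (Q i₂) → Adj G z (Q i₃) →
    (∀ i → Adj G z (Q i)) ⊎ InducesPath G (λ v → Adj G z v × Im Q v) →
    HasSectorWheel G
  sectorWheel {m} {Q} {z} hole z∉Q i₁ i₂ i₃ i₁≢i₂ i₁≢i₃ i₂≢i₃ a₁ a₂ a₃ sector =
    m , Q , z , (hole , (λ (i , e) → z∉Q i e) ,
      distinct³⇒3≤∣p∣ (∈-tabulate⁺ zQ a₁) (∈-tabulate⁺ zQ a₂) (∈-tabulate⁺ zQ a₃) i₁≢i₂ i₁≢i₃ i₂≢i₃) , sector
    where
    zQ : Fin m → Bool
    zQ i = adj z (Q i)

  universalWheel : ∀ {m} {Q : Fin m → Fin n} {z} → IsHole G Q → (∀ i → Q i ≢ z) →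
    (∀ i → Adj G z (Q i)) → HasSectorWheel G
  universalWheel hole@(s≤s (s≤s (s≤s (s≤s _))) , _) z∉Q all =
    sectorWheel hole z∉Q fzero (fsuc fzero) (fsuc (fsuc fzero)) (λ ()) (λ ()) (λ ())
      (all _) (all _) (all _) (inj₁ all)

  Adj? : ∀ u v → Dec (Adj G u v)
  Adj? u v = adj u v Bool.≟ true

  Im? : ∀ {m} (f : Fin m → Fin n) → Decidable (Im f)
  Im? f v = any? (λ i → f i Fin.≟ v)

  -- The wheel (w ∷ f , z) is universal if z ~ w, and has the sector f otherwise.
  apex-sectorWheel : ∀ {L} {f : Fin L → Fin n} → 3 ≤ L → IsInducedPath G f → ∀ {w z} → w ≢ z →
    (∀ i → f i ≢ w) → (∀ i → f i ≢ z) → (∀ i → Adj G w (f i) ⇔ (toℕ i ≡ 0 ⊎ suc (toℕ i) ≡ L)) →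
    (∀ i → Adj G z (f i)) → HasSectorWheel G
  apex-sectorWheel {L} {f} 3≤L@(s≤s (s≤s (s≤s _))) path {w} {z} w≢z w∉f z∉f w-adj z-adj = wheel (Adj? z w)
    where
    hole : IsHole G (w ∷ f)
    hole = ∷-isHole 3≤L path w w∉f w-adj
    z∉hole : ∀ i → (w ∷ f) i ≢ z
    z∉hole fzero    = w≢z
    z∉hole (fsuc i) = z∉f i
    wheel : Dec (Adj G z w) → HasSectorWheel G
    wheel (yes zw) = universalWheel hole z∉hole λ { fzero → zw ; (fsuc i) → z-adj i }
    wheel (no ¬zw) = sectorWheel hole z∉hole (fsuc fzero) (fsuc (fsuc fzero)) (fsuc (fsuc (fsuc fzero)))
      (λ ()) (λ ()) (λ ()) (z-adj _) (z-adj _) (z-adj _) (inj₂ (L , f , path , λ v → mk⇔ ⇒ (⇐ v)))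
      where
      ⇒ : ∀ {v} → Adj G z v × Im (w ∷ f) v → Im f v
      ⇒ (zv , fzero  , refl) = ⊥-elim (¬zw zv)
      ⇒ (_  , fsuc i , fi≡)  = i , fi≡
      ⇐ : ∀ v → Im f v → Adj G z v × Im (w ∷ f) v
      ⇐ v (i , fi≡) = subst (Adj G z) fi≡ (z-adj i) , fsuc i , fi≡

-- Flat paths and the sets A and B

module FlatPath {n : ℕ} (G : Graph n) {m : ℕ} (p : Fin (suc m) → Fin n) (flat : IsFlatPath G p) where

  p-injective : ∀ {i j} → p i ≡ p j → i ≡ j
  p-injective = proj₁ (proj₁ flat)

  p-adj : ∀ i j → Adj G (p i) (p j) ⇔ (suc (toℕ i) ≡ toℕ j ⊎ suc (toℕ j) ≡ toℕ i)
  p-adj = proj₂ (proj₁ flat)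

  p₁ pₖ : Fin n
  p₁ = p fzero
  pₖ = p (fromℕ m)

  InA InB : Fin n → Set
  InA v = Adj G p₁ v × ¬ Adj G pₖ v × ¬ VP G p v
  InB v = Adj G pₖ v × ¬ Adj G p₁ v × ¬ VP G p v

  VP? : Decidable (VP G p)
  VP? = Im? G p

  Common : Fin n → Set
  Common v = Adj G p₁ v × Adj G pₖ v

  A∩B≡∅ : ∀ {v} → InA v → ¬ InB v
  A∩B≡∅ (_ , ¬pₖ-v , _) (pₖ-v , _) = ¬pₖ-v pₖ-v

  InA? : Decidable InA
  InA? v = Adj? G p₁ v ×-dec (¬? (Adj? G pₖ v) ×-dec ¬? (VP? v))

  InB? : Decidable InB
  InB? v = Adj? G pₖ v ×-dec (¬? (Adj? G p₁ v) ×-dec ¬? (VP? v))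

  Interior : Fin (suc m) → Set
  Interior j = ∃ λ t → toℕ j ≡ suc t × suc t < m

  end-or-interior : ∀ j → j ≡ fzero ⊎ j ≡ fromℕ m ⊎ Interior j
  end-or-interior j = classify (toℕ j) refl
    where
    classify : ∀ a → toℕ j ≡ a → j ≡ fzero ⊎ j ≡ fromℕ m ⊎ Interior j
    classify zero    j≡ = inj₁ (toℕ-injective j≡)
    classify (suc t) j≡ with suc t ℕ.<? m
    ... | yes t<m = inj₂ (inj₂ (t , j≡ , t<m))
    ... | no  t≮m = inj₂ (inj₁ (toℕ-injective (trans j≡ (sym (trans (toℕ-fromℕ m)
          (ℕₚ.≤-antisym (ℕₚ.≮⇒≥ t≮m) (subst (_≤ m) j≡ (toℕ≤pred[n] j))))))))

  interior-neighbour∈P : ∀ {j v} → Interior j → Adj G (p j) v → VP G p v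
  interior-neighbour∈P {j} {v} (t , j≡ , t<m) pj-v = prev-or-next (v Fin.≟ p prev) (v Fin.≟ p next)
    where
    t≤m : t ≤ m
    t≤m = ℕₚ.<⇒≤ (ℕₚ.<-trans (ℕₚ.n<1+n t) t<m)
    prev next : Fin (suc m)
    prev = fromℕ≤ t≤m
    next = fromℕ≤ {a = suc (suc t)} t<m
    degree≡2 : degree G (p j) ≡ 2
    degree≡2 = proj₂ flat j (subst (0 <_) (sym j≡) (s≤s z≤n)) (subst (_< m) (sym j≡) t<m)
    N : Fin n → Bool
    N = Graph.adj G (p j)
    prev∈ : p prev ∈ Nbhd G (p j)
    prev∈ = ∈-tabulate⁺ N (from (p-adj j prev) (inj₂ (trans (cong suc (toℕ-fromℕ≤ t≤m)) (sym j≡))))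
    next∈ : p next ∈ Nbhd G (p j)
    next∈ = ∈-tabulate⁺ N (from (p-adj j next) (inj₁ (trans (cong suc j≡) (sym (toℕ-fromℕ≤ t<m)))))
    v∈ : v ∈ Nbhd G (p j)
    v∈ = ∈-tabulate⁺ N pj-v
    prev≢next : p prev ≢ p next
    prev≢next e = ℕₚ.<-irrefl (trans (sym (toℕ-fromℕ≤ t≤m)) (trans (cong toℕ (p-injective e)) (toℕ-fromℕ≤ t<m)))
                              (s≤s (ℕₚ.n≤1+n _))
    prev-or-next : Dec (v ≡ p prev) → Dec (v ≡ p next) → VP G p v
    prev-or-next (yes v≡)     _             = prev , sym v≡
    prev-or-next (no _)       (yes v≡)      = next , sym v≡
    prev-or-next (no v≢prev)  (no v≢next)   = ⊥-elim (ℕₚ.<-irrefl (sym degree≡2)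
      (distinct³⇒3≤∣p∣ prev∈ next∈ v∈ prev≢next (v≢prev ∘ sym) (v≢next ∘ sym)))

  neighbour∉P⇒end : ∀ j {v} → Adj G (p j) v → ¬ VP G p v → j ≡ fzero ⊎ j ≡ fromℕ m
  neighbour∉P⇒end j pj-v v∉P with end-or-interior j
  ... | inj₁ e          = inj₁ e
  ... | inj₂ (inj₁ e)   = inj₂ e
  ... | inj₂ (inj₂ int) = ⊥-elim (v∉P (interior-neighbour∈P int pj-v))

  NP∖VP⇒end-adjacent : ∀ {v} → NP G p v → ¬ VP G p v → Adj G p₁ v ⊎ Adj G pₖ v
  NP∖VP⇒end-adjacent (inj₁ v∈P)     v∉P = ⊥-elim (v∉P v∈P)
  NP∖VP⇒end-adjacent (inj₂ (j , a)) v∉P with neighbour∉P⇒end j a v∉P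
  ... | inj₁ refl = inj₁ a
  ... | inj₂ refl = inj₂ a

  InA⇒1≤m : ∀ {v} → InA v → 1 ≤ m
  InA⇒1≤m (p₁-v , ¬pₖ-v , _) = ℕₚ.n≢0⇒n>0 λ m≡0 → ¬pₖ-v (subst (λ x → Adj G x _) (p₁≡pₖ m≡0) p₁-v)
    where
    p₁≡pₖ : m ≡ 0 → p₁ ≡ pₖ
    p₁≡pₖ m≡0 = cong p (toℕ-injective (sym (trans (toℕ-fromℕ m) m≡0)))

  1≤m⇒p₁≢pₖ : 1 ≤ m → p₁ ≢ pₖ
  1≤m⇒p₁≢pₖ 1≤m e = ℕₚ.<-irrefl (trans (cong toℕ (p-injective e)) (toℕ-fromℕ m)) 1≤m

  A∷P-isInducedPath : ∀ {a} → InA a → IsInducedPath G (a ∷ p)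
  A∷P-isInducedPath {a} (p₁-a , ¬pₖ-a , a∉P) =
    ∷-isInducedPath G (proj₁ flat) a (λ i e → a∉P (i , e)) λ i → mk⇔ (⇒ i) (⇐ i)
    where
    ⇒ : ∀ i → Adj G a (p i) → toℕ i ≡ 0
    ⇒ i a-pi with neighbour∉P⇒end i (Adj-sym G a-pi) a∉P
    ... | inj₁ refl = refl
    ... | inj₂ refl = ⊥-elim (¬pₖ-a (Adj-sym G a-pi))
    ⇐ : ∀ i → toℕ i ≡ 0 → Adj G a (p i)
    ⇐ i i≡0 = subst (λ j → Adj G a (p j)) (toℕ-injective {j = i} (sym i≡0)) (Adj-sym G p₁-a)

  A-B-edge-isHole : ∀ {a b} → InA a → InB b → Adj G a b → IsHole G (b ∷ a ∷ p)
  A-B-edge-isHole {a} {b} a∈A@(_ , ¬pₖ-a , _) (pₖ-b , ¬p₁-b , b∉P) ab =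
    ∷-isHole G (s≤s (s≤s (InA⇒1≤m a∈A))) (A∷P-isInducedPath a∈A) b b∉ λ i → mk⇔ (⇒ i) (⇐ i)
    where
    b∉ : ∀ i → (a ∷ p) i ≢ b
    b∉ fzero    e = ¬pₖ-a (subst (Adj G pₖ) (sym e) pₖ-b)
    b∉ (fsuc i) e = b∉P (i , e)
    ⇒ : ∀ i → Adj G b ((a ∷ p) i) → toℕ i ≡ 0 ⊎ suc (toℕ i) ≡ suc (suc m)
    ⇒ fzero    _    = inj₁ refl
    ⇒ (fsuc j) b-pj with neighbour∉P⇒end j (Adj-sym G b-pj) b∉P
    ... | inj₁ refl = ⊥-elim (¬p₁-b (Adj-sym G b-pj))
    ... | inj₂ refl = inj₂ (cong (suc ∘ suc) (toℕ-fromℕ m))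
    ⇐ : ∀ i → toℕ i ≡ 0 ⊎ suc (toℕ i) ≡ suc (suc m) → Adj G b ((a ∷ p) i)
    ⇐ fzero    _        = Adj-sym G ab
    ⇐ (fsuc j) (inj₂ e) = subst (λ i → Adj G b (p i))
      (toℕ-injective {i = fromℕ m} (trans (toℕ-fromℕ m) (sym (ℕₚ.suc-injective (ℕₚ.suc-injective e)))))
      (Adj-sym G pₖ-b)

  chordal⇒¬A-B-edge : ∀ {W} → ChordalOn G W → (∀ {v} → VP G p v → v ∈ W) →
    ∀ {a b} → a ∈ W → b ∈ W → InA a → InB b → ¬ Adj G a b
  chordal⇒¬A-B-edge {W} chordal P⊆W {a} {b} a∈W b∈W a∈A b∈B ab =
    chordal (_ , b ∷ a ∷ p , A-B-edge-isHole a∈A b∈B ab , on-W)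
    where
    on-W : ∀ i → (b ∷ a ∷ p) i ∈ W
    on-W fzero           = b∈W
    on-W (fsuc fzero)    = a∈W
    on-W (fsuc (fsuc j)) = P⊆W (j , refl)

  module _ {k} {h : Fin (suc k) → Fin n} (hole : IsHole G h) where

    -- p (t+1) has degree 2, so its two neighbours on the hole are p t and p (t+2).
    hole∋p[1+t]⇒hole∋p[t] : ∀ t {j} → toℕ j ≡ suc t → suc t < m → Im G h (p j) →
      ∃ λ a → toℕ a ≡ t × Im G h (p a)
    hole∋p[1+t]⇒hole∋p[t] t {j} j≡ t<m (l , hl≡) with rotate-hole-at G hole l
    ... | h′ , hole′ , h′0≡ , same = choose (hole-neighbour 1 1≤k (inj₁ refl))
                                            (hole-neighbour k ℕₚ.≤-refl (inj₂ (inj₂ (inj₁ (refl , refl)))))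
      where
      open Indexed G hole′
      at0≡ : at 0 ≡ p j
      at0≡ = trans (at-toℕ fzero) (trans h′0≡ hl≡)
      PathNeighbour : ℕ → Set
      PathNeighbour b = ∃ λ (a : Fin (suc m)) → p a ≡ at b × (toℕ a ≡ t ⊎ toℕ a ≡ suc (suc t))
      hole-neighbour : ∀ b → b ≤ k → CycAdjℕ k 0 b → PathNeighbour b
      hole-neighbour b b≤k c = a , pa≡ , side (to (p-adj j a) (subst (Adj G (p j)) (sym pa≡) pj-b))
        where
        pj-b : Adj G (p j) (at b)
        pj-b = subst (λ x → Adj G x (at b)) at0≡ (CycAdjℕ⇒adj z≤n b≤k c)
        a : Fin (suc m)
        a = proj₁ (interior-neighbour∈P (t , j≡ , t<m) pj-b)
        pa≡ : p a ≡ at b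
        pa≡ = proj₂ (interior-neighbour∈P (t , j≡ , t<m) pj-b)
        side : suc (toℕ j) ≡ toℕ a ⊎ suc (toℕ a) ≡ toℕ j → toℕ a ≡ t ⊎ toℕ a ≡ suc (suc t)
        side (inj₁ e) = inj₂ (trans (sym e) (cong suc j≡))
        side (inj₂ e) = inj₁ (ℕₚ.suc-injective (trans e j≡))
      found : ∀ {b} → b ≤ k → ∀ a → p a ≡ at b → toℕ a ≡ t → ∃ λ a → toℕ a ≡ t × Im G h (p a)
      found b≤k a pa≡ a≡t = a , a≡t , to (same (p a)) (subst (Im G h′) (sym pa≡) (Im-at b≤k))
      choose : PathNeighbour 1 → PathNeighbour k → ∃ λ a → toℕ a ≡ t × Im G h (p a)
      choose (a , pa≡ , inj₁ a≡t) _                  = found 1≤k a pa≡ a≡t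
      choose _                   (b , pb≡ , inj₁ b≡t) = found ℕₚ.≤-refl b pb≡ b≡t
      choose (a , pa≡ , inj₂ a≡) (b , pb≡ , inj₂ b≡) = ⊥-elim (ℕₚ.<-irrefl
        (at-injective 1≤k ℕₚ.≤-refl (trans (sym pa≡) (trans (cong p (toℕ-injective (trans a≡ (sym b≡)))) pb≡)))
        (ℕₚ.<-trans (s≤s (s≤s z≤n)) 3≤k))

    hole∋interior⇒hole∋p₁ : ∀ {j} → Interior j → Im G h (p j) → Im G h p₁
    hole∋interior⇒hole∋p₁ (t , j≡ , t<m) = go t j≡ t<m
      where
      go : ∀ t {j} → toℕ j ≡ suc t → suc t < m → Im G h (p j) → Im G h p₁
      go zero    j≡ t<m on with hole∋p[1+t]⇒hole∋p[t] zero j≡ t<m on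
      ... | a , a≡0 , on′ = subst (Im G h) (cong p (toℕ-injective {j = fzero} a≡0)) on′
      go (suc t) j≡ t<m on with hole∋p[1+t]⇒hole∋p[t] (suc t) j≡ t<m on
      ... | a , a≡ , on′ = go t a≡ (ℕₚ.<-trans (ℕₚ.n<1+n _) t<m) on′

-- Holes inside N[P]

module NoSectorWheel {n : ℕ} (G : Graph n) (¬wheel : ¬ HasSectorWheel G)
                     {m : ℕ} (p : Fin (suc m) → Fin n) (flat : IsFlatPath G p) where
  open FlatPath G p flat

  -- The run s, …, t closes through pₖ into a hole on which p₁ sees every vertex except possibly pₖ.
  A-run⇒sectorWheel : ∀ {k} {h : Fin (suc k) → Fin n} (hole : IsHole G h) → (∀ {v} → Im G h v → ¬ VP G p v) →
    p₁ ≢ pₖ → let open Indexed G hole in ∀ {s t} → 1 ≤ s → 2 + s ≤ t → t ≤ k →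
    Common (at s) → Common (at t) → (∀ i → s < i → i < t → InA (at i)) → HasSectorWheel G
  A-run⇒sectorWheel {k} {h} hole h∩P≡∅ p₁≢pₖ {s} {t} 1≤s 2+s≤t t≤k s-common t-common run =
    apex-sectorWheel G (s≤s (ℕₚ.m+n≤o⇒m≤o∸n 2 2+s≤t)) (segment-isInducedPath s L s+L≤ (inj₁ 1≤s))
      (p₁≢pₖ ∘ sym) (λ i e → at∉P (≤k i) (fromℕ m , sym e))
      (λ i e → at∉P (≤k i) (fzero , sym e)) (λ i → mk⇔ (pₖ⇒ i) (pₖ⇐ i)) p₁-seg
    where
    open Indexed G hole
    at∉P : ∀ {a} → a ≤ k → ¬ VP G p (at a)
    at∉P a≤k = h∩P≡∅ (Im-at a≤k)
    s≤t : s ≤ t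
    s≤t = ℕₚ.m+n≤o⇒n≤o 2 2+s≤t
    L : ℕ
    L = suc (t ∸ s)
    s+[t∸s]≡t : s + (t ∸ s) ≡ t
    s+[t∸s]≡t = ℕₚ.m+[n∸m]≡n s≤t
    s+L≤ : s + L ≤ suc k
    s+L≤ = subst (_≤ suc k) (sym (trans (ℕₚ.+-suc s _) (cong suc s+[t∸s]≡t))) (s≤s t≤k)
    ≤t : ∀ (i : Fin L) → s + toℕ i ≤ t
    ≤t i = subst (s + toℕ i ≤_) s+[t∸s]≡t (ℕₚ.+-monoʳ-≤ s (ℕₚ.≤-pred (toℕ<n i)))
    ≤k : ∀ (i : Fin L) → s + toℕ i ≤ k
    ≤k i = ℕₚ.≤-trans (≤t i) t≤k
    at-first : ∀ {i : Fin L} → toℕ i ≡ 0 → at (s + toℕ i) ≡ at s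
    at-first i≡0 = cong at (trans (cong (s +_) i≡0) (ℕₚ.+-identityʳ s))
    at-last : ∀ {i : Fin L} → toℕ i ≡ t ∸ s → at (s + toℕ i) ≡ at t
    at-last i≡ = cong at (trans (cong (s +_) i≡) s+[t∸s]≡t)
    position : ∀ (i : Fin L) → toℕ i ≡ 0 ⊎ toℕ i ≡ t ∸ s ⊎ InA (at (s + toℕ i))
    position i with toℕ i ℕ.≟ 0 | toℕ i ℕ.≟ t ∸ s
    ... | yes i≡0 | _      = inj₁ i≡0
    ... | no  _   | yes i≡ = inj₂ (inj₁ i≡)
    ... | no  i≢0 | no i≢  = inj₂ (inj₂ (run _ (ℕₚ.m<m+n s (ℕₚ.n≢0⇒n>0 i≢0))
                              (ℕₚ.≤∧≢⇒< (≤t i) (i≢ ∘ ℕₚ.+-cancelˡ-≡ s _ _ ∘ flip trans (sym s+[t∸s]≡t)))))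
    pₖ⇒ : ∀ i → Adj G pₖ (at (s + toℕ i)) → toℕ i ≡ 0 ⊎ suc (toℕ i) ≡ L
    pₖ⇒ i pₖ-i with position i
    ... | inj₁ i≡0        = inj₁ i≡0
    ... | inj₂ (inj₁ i≡)  = inj₂ (cong suc i≡)
    ... | inj₂ (inj₂ i∈A) = ⊥-elim (proj₁ (proj₂ i∈A) pₖ-i)
    pₖ⇐ : ∀ i → toℕ i ≡ 0 ⊎ suc (toℕ i) ≡ L → Adj G pₖ (at (s + toℕ i))
    pₖ⇐ i (inj₁ i≡0) = subst (Adj G pₖ) (sym (at-first i≡0)) (proj₂ s-common)
    pₖ⇐ i (inj₂ i≡)  = subst (Adj G pₖ) (sym (at-last (ℕₚ.suc-injective i≡))) (proj₂ t-common)
    p₁-seg : ∀ i → Adj G p₁ (at (s + toℕ i))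
    p₁-seg i with position i
    ... | inj₁ i≡0        = subst (Adj G p₁) (sym (at-first i≡0)) (proj₁ s-common)
    ... | inj₂ (inj₁ i≡)  = subst (Adj G p₁) (sym (at-last i≡)) (proj₁ t-common)
    ... | inj₂ (inj₂ i∈A) = proj₁ i∈A

  module _ {k} {h : Fin (suc k) → Fin n} (hole : IsHole G h)
           (h⊆N[P] : ∀ {v} → Im G h v → NP G p v)
           (¬A-B : ∀ {a b} → Im G h a → Im G h b → InA a → InB b → ¬ Adj G a b) where

    -- The neighbour w ≠ p₁ of u on the hole is not adjacent to p₁, hence lies in B.
    hole∋A⇒hole∌p₁ : ∀ {u} → Im G h u → InA u → ¬ Im G h p₁
    hole∋A⇒hole∌p₁ {u} u-on@(l , hl≡) u∈A@(p₁-u , ¬pₖ-u , u∉P) p₁-on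
      with rotate-hole-at G hole l
    ... | h′ , hole′ , h′0≡ , same = p₁-neighbour (Im⇒at (from (same p₁) p₁-on))
      where
      open Indexed G hole′
      at0≡ : at 0 ≡ u
      at0≡ = trans (at-toℕ fzero) (trans h′0≡ hl≡)
      1≢k : 1 ≢ k
      1≢k 1≡k = ℕₚ.<-irrefl 1≡k (ℕₚ.<-trans (s≤s (s≤s z≤n)) 3≤k)
      other-neighbour : ∀ {a b} → a ≤ k → b ≤ k → at a ≡ p₁ → CycAdjℕ k 0 b → ¬ CycAdjℕ k a b → a ≢ b → ⊥
      other-neighbour {a} {b} a≤k b≤k at-a≡ 0~b a≁b a≢b =
        ¬A-B u-on (to (same _) (Im-at b≤k)) u∈A w∈B u-w
        where
        w : Fin n
        w = at b
        u-w : Adj G u w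
        u-w = subst (λ x → Adj G x w) at0≡ (CycAdjℕ⇒adj z≤n b≤k 0~b)
        ¬p₁-w : ¬ Adj G p₁ w
        ¬p₁-w p₁-w = a≁b (adj⇒CycAdjℕ a≤k b≤k (subst (λ x → Adj G x w) (sym at-a≡) p₁-w))
        w∉P : ¬ VP G p w
        w∉P (j , pj≡) with neighbour∉P⇒end j (subst (λ x → Adj G x u) (sym pj≡) (Adj-sym G u-w)) u∉P
        ... | inj₁ refl = a≢b (at-injective a≤k b≤k (trans at-a≡ pj≡))
        ... | inj₂ refl = ¬pₖ-u (subst (λ x → Adj G x u) (sym pj≡) (Adj-sym G u-w))
        w∈B : InB w
        w∈B with NP∖VP⇒end-adjacent (h⊆N[P] (to (same w) (Im-at b≤k))) w∉P
        ... | inj₁ p₁-w = ⊥-elim (¬p₁-w p₁-w)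
        ... | inj₂ pₖ-w = pₖ-w , ¬p₁-w , w∉P
      p₁-neighbour : (∃ λ a → a ≤ k × at a ≡ p₁) → ⊥
      p₁-neighbour (a , a≤k , at-a≡)
        with CycAdjℕ-0 3≤k (adj⇒CycAdjℕ z≤n a≤k (subst₂ (Adj G) (sym at0≡) (sym at-a≡) (Adj-sym G p₁-u)))
      ... | inj₁ refl = other-neighbour a≤k ℕₚ.≤-refl at-a≡ (inj₂ (inj₂ (inj₁ (refl , refl))))
                          (¬CycAdjℕ-1-k 3≤k) 1≢k
      ... | inj₂ refl = other-neighbour a≤k 1≤k at-a≡ (inj₁ refl) (¬CycAdjℕ-1-k 3≤k ∘ CycAdjℕ-sym) (1≢k ∘ sym)

    -- With pₖ at position 0, every other hole vertex sees p₁: the inner ones lie in A, and an end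
    -- not seeing p₁ would be a B-vertex next to an inner one.
    hole∩P⊆pₖ⇒hole∌pₖ : ¬ Im G h p₁ → (∀ {v} → Im G h v → VP G p v → v ≡ pₖ) → ¬ Im G h pₖ
    hole∩P⊆pₖ⇒hole∌pₖ p₁∉h P∩h⊆pₖ pₖ-on@(l , hl≡) with rotate-hole-at G hole l
    ... | h′ , hole′ , h′0≡ , same =
      ¬wheel (apex-sectorWheel G 3≤k (segment-isInducedPath 1 k ℕₚ.≤-refl (inj₁ ℕₚ.≤-refl))
        (λ pₖ≡p₁ → p₁∉h (subst (Im G h) pₖ≡p₁ pₖ-on))
        (λ i e → at∉P (toℕ<n i) (λ ()) (fromℕ m , sym e))
        (λ i e → p₁∉h (subst (Im G h) e (on-h (toℕ<n i))))
        (λ i → mk⇔ (pₖ-seg⇒ i) (pₖ-seg⇐ i))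
        (λ i → p₁-at (s≤s z≤n) (toℕ<n i)))
      where
      open Indexed G hole′
      at0≡ : at 0 ≡ pₖ
      at0≡ = trans (at-toℕ fzero) (trans h′0≡ hl≡)
      on-h : ∀ {a} → a ≤ k → Im G h (at a)
      on-h a≤k = to (same _) (Im-at a≤k)
      at∉P : ∀ {a} → a ≤ k → a ≢ 0 → ¬ VP G p (at a)
      at∉P a≤k a≢0 at∈P = a≢0 (at-injective a≤k z≤n (trans (P∩h⊆pₖ (on-h a≤k) at∈P) (sym at0≡)))
      pₖ-at⇒end : ∀ {a} → a ≤ k → Adj G pₖ (at a) → a ≡ 1 ⊎ a ≡ k
      pₖ-at⇒end a≤k pₖ-a = CycAdjℕ-0 3≤k (adj⇒CycAdjℕ z≤n a≤k (subst (λ x → Adj G x _) (sym at0≡) pₖ-a))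
      end⇒pₖ-at : ∀ {a} → a ≤ k → CycAdjℕ k 0 a → Adj G pₖ (at a)
      end⇒pₖ-at a≤k 0~a = subst (λ x → Adj G x _) at0≡ (CycAdjℕ⇒adj z≤n a≤k 0~a)
      inner∈A : ∀ {a} → a ≤ k → a ≢ 0 → a ≢ 1 → a ≢ k → InA (at a)
      inner∈A {a} a≤k a≢0 a≢1 a≢k with NP∖VP⇒end-adjacent (h⊆N[P] (on-h a≤k)) (at∉P a≤k a≢0)
      ... | inj₁ p₁-a = p₁-a , (λ pₖ-a → [ a≢1 , a≢k ] (pₖ-at⇒end a≤k pₖ-a)) , at∉P a≤k a≢0
      ... | inj₂ pₖ-a = ⊥-elim ([ a≢1 , a≢k ] (pₖ-at⇒end a≤k pₖ-a))
      end⇒p₁-at : ∀ {a b} → a ≤ k → b ≤ k → a ≢ 0 → CycAdjℕ k 0 a → b ≢ 0 → b ≢ 1 → b ≢ k →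
        CycAdjℕ k b a → Adj G p₁ (at a)
      end⇒p₁-at {a} {b} a≤k b≤k a≢0 0~a b≢0 b≢1 b≢k b~a with Adj? G p₁ (at a)
      ... | yes p₁-a = p₁-a
      ... | no ¬p₁-a = ⊥-elim (¬A-B (on-h b≤k) (on-h a≤k) (inner∈A b≤k b≢0 b≢1 b≢k)
                        (end⇒pₖ-at a≤k 0~a , ¬p₁-a , at∉P a≤k a≢0) (CycAdjℕ⇒adj b≤k a≤k b~a))
      2≤k∸1 : 2 ≤ k ∸ 1
      2≤k∸1 = ℕₚ.∸-monoˡ-≤ 1 3≤k
      k∸1<k : k ∸ 1 < k
      k∸1<k = ℕₚ.∸-monoʳ-< (s≤s z≤n) 1≤k
      p₁-at : ∀ {a} → 1 ≤ a → a ≤ k → Adj G p₁ (at a)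
      p₁-at {a} 1≤a a≤k with a ℕ.≟ 1 | a ℕ.≟ k
      ... | yes refl | _ = end⇒p₁-at {b = 2} a≤k (ℕₚ.<-trans (s≤s (s≤s z≤n)) 3≤k) (λ ()) (inj₁ refl)
                             (λ ()) (λ ()) (λ 2≡k → ℕₚ.<-irrefl 2≡k 3≤k) (inj₂ (inj₁ refl))
      ... | no _ | yes refl = end⇒p₁-at {b = k ∸ 1} a≤k (ℕₚ.<⇒≤ k∸1<k) (ℕₚ.<⇒≢ 1≤a ∘ sym)
                                (inj₂ (inj₂ (inj₁ (refl , refl))))
                                (ℕₚ.<⇒≢ (ℕₚ.<-trans (s≤s z≤n) 2≤k∸1) ∘ sym) (ℕₚ.<⇒≢ 2≤k∸1 ∘ sym) (ℕₚ.<⇒≢ k∸1<k)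
                                (inj₁ (ℕₚ.m+[n∸m]≡n 1≤a))
      ... | no a≢1 | no a≢k = proj₁ (inner∈A a≤k (ℕₚ.<⇒≢ 1≤a ∘ sym) a≢1 a≢k)
      pₖ-seg⇒ : ∀ (i : Fin k) → Adj G pₖ (at (1 + toℕ i)) → toℕ i ≡ 0 ⊎ suc (toℕ i) ≡ k
      pₖ-seg⇒ i pₖ-i with pₖ-at⇒end (toℕ<n i) pₖ-i
      ... | inj₁ e = inj₁ (ℕₚ.suc-injective e)
      ... | inj₂ e = inj₂ e
      pₖ-seg⇐ : ∀ (i : Fin k) → toℕ i ≡ 0 ⊎ suc (toℕ i) ≡ k → Adj G pₖ (at (1 + toℕ i))
      pₖ-seg⇐ i (inj₁ e) = end⇒pₖ-at (toℕ<n i) (inj₁ (cong suc (sym e)))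
      pₖ-seg⇐ i (inj₂ e) = end⇒pₖ-at (toℕ<n i) (inj₂ (inj₂ (inj₁ (refl , cong suc e))))

    -- A hole vertex missed by p₁ lies in B, so the maximal run of A-vertices through u is bounded
    -- by common neighbours of p₁ and pₖ.
    hole∩P≡∅⇒hole∌A : (∀ {v} → Im G h v → ¬ VP G p v) → ∀ {u} → Im G h u → ¬ InA u
    hole∩P≡∅⇒hole∌A h∩P≡∅ {u} u-on u∈A with all? (λ i → Adj? G p₁ (h i))
    ... | yes p₁-all = ¬wheel (universalWheel G hole (λ i e → h∩P≡∅ (i , e) (fzero , refl)) p₁-all)
    ... | no ¬p₁-all with ¬∀⟶∃¬ (suc k) _ (λ i → Adj? G p₁ (h i)) ¬p₁-all
    ...   | l , ¬p₁-hl with rotate-hole-at G hole l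
    ...     | h′ , hole′ , h′0≡ , same with Indexed.Im⇒at G hole′ (from (same u) u-on)
    ...       | j , j≤k , at-j≡ =
      around-u (last-failure-below A? (¬p₁-at0 ∘ proj₁) u∈A′) (first-failure-above A? k j≤k u∈A′)
      where
      open Indexed G hole′
      on-h : ∀ {a} → a ≤ k → Im G h (at a)
      on-h a≤k = to (same _) (Im-at a≤k)
      at∉P : ∀ {a} → a ≤ k → ¬ VP G p (at a)
      at∉P a≤k = h∩P≡∅ (on-h a≤k)
      A-at : ℕ → Set
      A-at a = InA (at a)
      A? : Decidable A-at
      A? a = InA? (at a)
      ¬p₁-at0 : ¬ Adj G p₁ (at 0)
      ¬p₁-at0 p₁-0 = ¬p₁-hl (subst (Adj G p₁) (trans (at-toℕ fzero) h′0≡) p₁-0)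
      at0∈B : InB (at 0)
      at0∈B with NP∖VP⇒end-adjacent (h⊆N[P] (on-h z≤n)) (at∉P z≤n)
      ... | inj₁ p₁-0 = ⊥-elim (¬p₁-at0 p₁-0)
      ... | inj₂ pₖ-0 = pₖ-0 , ¬p₁-at0 , at∉P z≤n
      u∈A′ : InA (at j)
      u∈A′ = subst InA (sym at-j≡) u∈A
      boundary-common : ∀ {a b} → a ≤ k → b ≤ k → InA (at b) → ¬ InA (at a) → Adj G (at b) (at a) → Common (at a)
      boundary-common {a} {b} a≤k b≤k b∈A a∉A ba with NP∖VP⇒end-adjacent (h⊆N[P] (on-h a≤k)) (at∉P a≤k)
      ... | inj₁ p₁-a with Adj? G pₖ (at a)
      ...   | yes pₖ-a = p₁-a , pₖ-a
      ...   | no ¬pₖ-a = ⊥-elim (a∉A (p₁-a , ¬pₖ-a , at∉P a≤k))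
      boundary-common {a} {b} a≤k b≤k b∈A a∉A ba | inj₂ pₖ-a with Adj? G p₁ (at a)
      ...   | yes p₁-a = p₁-a , pₖ-a
      ...   | no ¬p₁-a = ⊥-elim (¬A-B (on-h b≤k) (on-h a≤k) b∈A (pₖ-a , ¬p₁-a , at∉P a≤k) ba)
      around-u : (∃ λ s → s < j × ¬ A-at s × (∀ i → s < i → i ≤ j → A-at i)) →
        (∀ i → j ≤ i → i ≤ k → A-at i) ⊎ (∃ λ t → j < t × t ≤ k × ¬ A-at t × (∀ i → j ≤ i → i < t → A-at i)) → ⊥
      around-u _ (inj₁ run) =
        ¬A-B (on-h ℕₚ.≤-refl) (on-h z≤n) (run k j≤k ℕₚ.≤-refl) at0∈B
          (CycAdjℕ⇒adj ℕₚ.≤-refl z≤n (inj₂ (inj₂ (inj₂ (refl , refl)))))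
      around-u _ (inj₂ (zero , () , _))
      around-u (s , s<j , s∉A , run⁻) (inj₂ (suc t , j<t , t<k , t+1∉A , run⁺)) =
        ¬wheel (A-run⇒sectorWheel hole′ (h∩P≡∅ ∘ to (same _)) (1≤m⇒p₁≢pₖ (InA⇒1≤m u∈A))
                  1≤s (ℕₚ.≤-trans (s≤s s<j) j<t) t<k s-common t+1-common run)
        where
        s<k : s < k
        s<k = ℕₚ.<-≤-trans s<j j≤k
        t≤k : t ≤ k
        t≤k = ℕₚ.<⇒≤ t<k
        s-common : Common (at s)
        s-common = boundary-common (ℕₚ.<⇒≤ s<k) s<k (run⁻ (suc s) (ℕₚ.n<1+n s) s<j) s∉A
                     (CycAdjℕ⇒adj s<k (ℕₚ.<⇒≤ s<k) (inj₂ (inj₁ refl)))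
        t+1-common : Common (at (suc t))
        t+1-common = boundary-common t<k t≤k (run⁺ t (ℕₚ.≤-pred j<t) (ℕₚ.n<1+n t)) t+1∉A
                       (CycAdjℕ⇒adj t≤k t<k (inj₁ refl))
        1≤s : 1 ≤ s
        1≤s = ℕₚ.n≢0⇒n>0 λ { refl → ¬p₁-at0 (proj₁ s-common) }
        run : ∀ i → s < i → i < suc t → InA (at i)
        run i s<i i<t with i ℕ.≤? j
        ... | yes i≤j = run⁻ i s<i i≤j
        ... | no  i≰j = run⁺ i (ℕₚ.<⇒≤ (ℕₚ.≰⇒> i≰j)) i<t

    hole∌A : ∀ {u} → Im G h u → ¬ InA u
    hole∌A u-on u∈A with Im? G h p₁
    ... | yes p₁-on = hole∋A⇒hole∌p₁ u-on u∈A p₁-on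
    ... | no  p₁∉h with any? (λ j → Im? G h (p j))
    ...   | no  P∉h        = hole∩P≡∅⇒hole∌A (λ v-on (j , pj≡) → P∉h (j , subst (Im G h) (sym pj≡) v-on)) u-on u∈A
    ...   | yes (j , pj-on) = hole∩P⊆pₖ⇒hole∌pₖ p₁∉h P∩h⊆pₖ (subst (Im G h ∘ p) (on-P⇒last pj-on) pj-on)
      where
      on-P⇒last : ∀ {j} → Im G h (p j) → j ≡ fromℕ m
      on-P⇒last {j} pj-on with end-or-interior j
      ... | inj₁ refl          = ⊥-elim (p₁∉h pj-on)
      ... | inj₂ (inj₁ j≡)     = j≡
      ... | inj₂ (inj₂ j-int)  = ⊥-elim (p₁∉h (hole∋interior⇒hole∋p₁ hole j-int pj-on))
      P∩h⊆pₖ : ∀ {v} → Im G h v → VP G p v → v ≡ pₖ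
      P∩h⊆pₖ v-on (j , pj≡) = trans (sym pj≡) (cong p (on-P⇒last (subst (Im G h) (sym pj≡) v-on)))

  -- Two A-neighbours a, a′ of b close b-a-p₁-a′ into a 4-hole unless a ~ a′, and then a′ is the
  -- centre of a sector wheel on the hole b-a-P through its neighbours b, a, p₁.
  A-neighbour-unique : ¬ EvenHole G → ∀ {a a′ b} → InB b → InA a → InA a′ → Adj G a b → Adj G a′ b → a ≡ a′
  A-neighbour-unique ¬even-hole {a} {a′} {b} b∈B@(pₖ-b , ¬p₁-b , b∉P) a∈A@(p₁-a , ¬pₖ-a , a∉P)
                     (p₁-a′ , ¬pₖ-a′ , a′∉P) ab a′b with a Fin.≟ a′
  ... | yes a≡a′ = a≡a′
  ... | no  a≢a′ with Adj? G a a′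
  ...   | no ¬aa′ = ⊥-elim (¬even-hole (4 , b ∷ a ∷ p₁ ∷ a′ ∷ [] , four-hole , divides 2 refl))
    where
    p₁a′ : IsInducedPath G (p₁ ∷ a′ ∷ [])
    p₁a′ = ∷-isInducedPath G ([]-isInducedPath G a′) p₁ (λ { fzero e → a′∉P (fzero , sym e) })
             λ { fzero → mk⇔ (λ _ → refl) (λ _ → p₁-a′) }
    ap₁a′ : IsInducedPath G (a ∷ p₁ ∷ a′ ∷ [])
    ap₁a′ = ∷-isInducedPath G p₁a′ a (λ { fzero e → a∉P (fzero , e) ; (fsuc fzero) e → a≢a′ (sym e) })
              λ { fzero → mk⇔ (λ _ → refl) (λ _ → Adj-sym G p₁-a)
                ; (fsuc fzero) → mk⇔ (⊥-elim ∘ ¬aa′) λ () }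
    four-hole : IsHole G (b ∷ a ∷ p₁ ∷ a′ ∷ [])
    four-hole = ∷-isHole G (s≤s (s≤s (s≤s z≤n))) ap₁a′ b
      (λ { fzero e → ¬pₖ-a (subst (Adj G pₖ) (sym e) pₖ-b)
         ; (fsuc fzero) e → b∉P (fzero , e)
         ; (fsuc (fsuc fzero)) e → ¬pₖ-a′ (subst (Adj G pₖ) (sym e) pₖ-b) })
      λ { fzero → mk⇔ (λ _ → inj₁ refl) (λ _ → Adj-sym G ab)
        ; (fsuc fzero) → mk⇔ (⊥-elim ∘ ¬p₁-b ∘ Adj-sym G) λ { (inj₁ ()) ; (inj₂ ()) }
        ; (fsuc (fsuc fzero)) → mk⇔ (λ _ → inj₂ refl) (λ _ → Adj-sym G a′b) }
  ...   | yes aa′ = ⊥-elim (¬wheel (sectorWheel G hole a′∉Q fzero (fsuc fzero) (fsuc (fsuc fzero))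
                      (λ ()) (λ ()) (λ ()) a′b (Adj-sym G aa′) (Adj-sym G p₁-a′) (inj₂ (3 , b ∷ a ∷ p₁ ∷ [] , bap₁ , λ v → mk⇔ ⇒ ⇐))))
    where
    Q : Fin (3 + m) → Fin n
    Q = b ∷ a ∷ p
    hole : IsHole G Q
    hole = A-B-edge-isHole a∈A b∈B ab
    a′∉Q : ∀ i → Q i ≢ a′
    a′∉Q fzero           e = ¬pₖ-a′ (subst (Adj G pₖ) e pₖ-b)
    a′∉Q (fsuc fzero)    e = a≢a′ e
    a′∉Q (fsuc (fsuc j)) e = a′∉P (j , e)
    ap₁ : IsInducedPath G (a ∷ p₁ ∷ [])
    ap₁ = ∷-isInducedPath G ([]-isInducedPath G p₁) a (λ { fzero e → a∉P (fzero , e) })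
            λ { fzero → mk⇔ (λ _ → refl) (λ _ → Adj-sym G p₁-a) }
    bap₁ : IsInducedPath G (b ∷ a ∷ p₁ ∷ [])
    bap₁ = ∷-isInducedPath G ap₁ b
      (λ { fzero e → ¬pₖ-a (subst (Adj G pₖ) (sym e) pₖ-b) ; (fsuc fzero) e → b∉P (fzero , e) })
      λ { fzero → mk⇔ (λ _ → refl) (λ _ → Adj-sym G ab)
        ; (fsuc fzero) → mk⇔ (⊥-elim ∘ ¬p₁-b ∘ Adj-sym G) λ () }
    ⇒ : ∀ {v} → Adj G a′ v × Im G Q v → Im G (b ∷ a ∷ p₁ ∷ []) v
    ⇒ (_ , fzero , e)           = fzero , e
    ⇒ (_ , fsuc fzero , e)      = fsuc fzero , e
    ⇒ (a′-v , fsuc (fsuc j) , e) with neighbour∉P⇒end j (Adj-sym G (subst (Adj G a′) (sym e) a′-v)) a′∉P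
    ... | inj₁ refl = fsuc (fsuc fzero) , e
    ... | inj₂ refl = ⊥-elim (¬pₖ-a′ (Adj-sym G (subst (Adj G a′) (sym e) a′-v)))
    ⇐ : ∀ {v} → Im G (b ∷ a ∷ p₁ ∷ []) v → Adj G a′ v × Im G Q v
    ⇐ (fzero , refl)               = a′b , fzero , refl
    ⇐ (fsuc fzero , refl)          = Adj-sym G aa′ , fsuc fzero , refl
    ⇐ (fsuc (fsuc fzero) , refl)   = Adj-sym G p₁-a′ , fsuc (fsuc fzero) , refl

-- Reversing a flat path

∸-consecutive⁻ : ∀ m {a b} → a ≤ m → b ≤ m → suc (m ∸ a) ≡ m ∸ b → suc b ≡ a
∸-consecutive⁻ m {a} {b} a≤m b≤m e = ℕₚ.+-cancelˡ-≡ (m ∸ a) _ _ (begin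
  m ∸ a + suc b    ≡⟨ ℕₚ.+-suc (m ∸ a) b ⟩
  suc (m ∸ a) + b  ≡⟨ cong (_+ b) e ⟩
  m ∸ b + b        ≡⟨ ℕₚ.m∸n+n≡m b≤m ⟩
  m                ≡⟨ ℕₚ.m∸n+n≡m a≤m ⟨
  m ∸ a + a        ∎)
  where open ≡-Reasoning

∸-consecutive⁺ : ∀ m {a b} → a ≤ m → suc b ≡ a → suc (m ∸ a) ≡ m ∸ b
∸-consecutive⁺ m a≤m refl = sym (ℕₚ.+-∸-assoc 1 a≤m)

module Reversed {n : ℕ} (G : Graph n) {m : ℕ} (p : Fin (suc m) → Fin n) (flat : IsFlatPath G p) where

  module P = FlatPath G p flat

  p⁻ : Fin (suc m) → Fin n
  p⁻ = p ∘ opposite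

  reverse-isFlatPath : IsFlatPath G p⁻
  reverse-isFlatPath = (inj , λ i j → mk⇔ (⇒ i j) (⇐ i j)) , degree≡2
    where
    open P using (p-injective; p-adj)
    toℕ-opp : ∀ (i : Fin (suc m)) → toℕ (opposite i) ≡ m ∸ toℕ i
    toℕ-opp = opposite-prop
    inj : ∀ {i j} → p⁻ i ≡ p⁻ j → i ≡ j
    inj {i} {j} e = trans (sym (opposite-involutive i))
      (trans (cong opposite (p-injective e)) (opposite-involutive j))
    ⇒ : ∀ i j → Adj G (p⁻ i) (p⁻ j) → suc (toℕ i) ≡ toℕ j ⊎ suc (toℕ j) ≡ toℕ i
    ⇒ i j a with to (p-adj (opposite i) (opposite j)) a
    ... | inj₁ e = inj₂ (∸-consecutive⁻ m (toℕ≤pred[n] i) (toℕ≤pred[n] j)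
                    (trans (cong suc (sym (toℕ-opp i))) (trans e (toℕ-opp j))))
    ... | inj₂ e = inj₁ (∸-consecutive⁻ m (toℕ≤pred[n] j) (toℕ≤pred[n] i)
                    (trans (cong suc (sym (toℕ-opp j))) (trans e (toℕ-opp i))))
    ⇐ : ∀ i j → suc (toℕ i) ≡ toℕ j ⊎ suc (toℕ j) ≡ toℕ i → Adj G (p⁻ i) (p⁻ j)
    ⇐ i j (inj₁ e) = from (p-adj (opposite i) (opposite j)) (inj₂ (trans (cong suc (toℕ-opp j))
      (trans (∸-consecutive⁺ m (toℕ≤pred[n] j) e) (sym (toℕ-opp i)))))
    ⇐ i j (inj₂ e) = from (p-adj (opposite i) (opposite j)) (inj₁ (trans (cong suc (toℕ-opp i))
      (trans (∸-consecutive⁺ m (toℕ≤pred[n] i) e) (sym (toℕ-opp j)))))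
    degree≡2 : ∀ i → 0 < toℕ i → toℕ i < m → degree G (p⁻ i) ≡ 2
    degree≡2 i 0<i i<m = proj₂ flat (opposite i) (subst (0 <_) (sym (toℕ-opp i)) (ℕₚ.m<n⇒0<n∸m i<m))
      (subst (_< m) (sym (toℕ-opp i)) (ℕₚ.∸-monoʳ-< 0<i (ℕₚ.<⇒≤ i<m)))

  VP⁻⇔VP : ∀ {v} → VP G p⁻ v ⇔ VP G p v
  VP⁻⇔VP = mk⇔ (λ (i , e) → opposite i , e) (λ (i , e) → opposite i , trans (cong p (opposite-involutive i)) e)

  NP⇒NP⁻ : ∀ {v} → NP G p v → NP G p⁻ v
  NP⇒NP⁻ (inj₁ v∈P)     = inj₁ (from VP⁻⇔VP v∈P)
  NP⇒NP⁻ {v} (inj₂ (i , pi-v)) = inj₂ (opposite i , subst (λ j → Adj G (p j) v) (sym (opposite-involutive i)) pi-v)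

  module P⁻ = FlatPath G p⁻ reverse-isFlatPath

  p⁻ₖ≡p₁ : P⁻.pₖ ≡ P.p₁
  p⁻ₖ≡p₁ = cong p (toℕ-injective
    (trans (opposite-prop (fromℕ m)) (trans (cong (m ∸_) (toℕ-fromℕ m)) (ℕₚ.n∸n≡0 m))))

  InA⁻⇔InB : ∀ {v} → P⁻.InA v ⇔ P.InB v
  InA⁻⇔InB {v} = mk⇔ (λ (x , y , z) → x , y ∘ subst (λ u → Adj G u v) (sym p⁻ₖ≡p₁) , z ∘ from VP⁻⇔VP)
                     (λ (x , y , z) → x , y ∘ subst (λ u → Adj G u v) p⁻ₖ≡p₁ , z ∘ to VP⁻⇔VP)

  InB⁻⇔InA : ∀ {v} → P⁻.InB v ⇔ P.InA v
  InB⁻⇔InA {v} = mk⇔ (λ (x , y , z) → subst (λ u → Adj G u v) p⁻ₖ≡p₁ x , y , z ∘ from VP⁻⇔VP)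
                     (λ (x , y , z) → subst (λ u → Adj G u v) (sym p⁻ₖ≡p₁) x , y , z ∘ to VP⁻⇔VP)

module _ {n : ℕ} (G : Graph n) (¬wheel : ¬ HasSectorWheel G)
         {m : ℕ} (p : Fin (suc m) → Fin n) (flat : IsFlatPath G p) where
  open FlatPath G p flat
  open Reversed G p flat using (p⁻; reverse-isFlatPath; NP⇒NP⁻; InA⁻⇔InB; InB⁻⇔InA)
  private
    module Forward  = NoSectorWheel G ¬wheel p flat
    module Backward = NoSectorWheel G ¬wheel p⁻ reverse-isFlatPath

  -- Reading P backwards swaps A and B, so a new vertex in B is handled like one in A.
  chordal-extension : ∀ {W W′} → ChordalOn G W → (∀ {v} → v ∈ W′ → NP G p v) →
    (∀ {v} → v ∈ W′ → v ∉ W → InA v ⊎ InB v) →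
    (∀ {a b} → a ∈ W′ → b ∈ W′ → InA a → InB b → ¬ Adj G a b) → ChordalOn G W′
  chordal-extension _ _ _ _ (zero , _ , (() , _) , _)
  chordal-extension {W} {W′} chordal W′⊆N[P] new∈A⊎B ¬A-B (suc k , h , hole , h⊆W′) =
    old-or-new (all? (λ i → h i ∈? W))
    where
    on-W′ : ∀ {v} → Im G h v → v ∈ W′
    on-W′ (j , hj≡) = subst (_∈ W′) hj≡ (h⊆W′ j)
    new-vertex : ∀ i → h i ∉ W → ⊥
    new-vertex i hi∉W with new∈A⊎B (h⊆W′ i) hi∉W
    ... | inj₁ hi∈A = Forward.hole∌A hole (W′⊆N[P] ∘ on-W′) (λ a-on b-on → ¬A-B (on-W′ a-on) (on-W′ b-on))
                        (i , refl) hi∈A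
    ... | inj₂ hi∈B = Backward.hole∌A hole (NP⇒NP⁻ ∘ W′⊆N[P] ∘ on-W′)
                        (λ a-on b-on a∈A⁻ b∈B⁻ ab → ¬A-B (on-W′ b-on) (on-W′ a-on)
                           (to InB⁻⇔InA b∈B⁻) (to InA⁻⇔InB a∈A⁻) (Adj-sym G ab))
                        (i , refl) (from InA⁻⇔InB hi∈B)
    old-or-new : Dec (∀ i → h i ∈ W) → ⊥
    old-or-new (yes h⊆W) = chordal (suc k , h , hole , h⊆W)
    old-or-new (no  h⊈W) = uncurry new-vertex (¬∀⟶∃¬ (suc k) _ (λ i → h i ∈? W) h⊈W)

-- Extending W₁ and W₂

module Construction {n : ℕ} (G : Graph n) (¬even-hole : ¬ EvenHole G) (¬wheel : ¬ HasSectorWheel G)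
  {m : ℕ} (p : Fin (suc m) → Fin n) (flat : IsFlatPath G p) (W₁ W₂ : Subset n)
  (W₁∩W₂ : ∀ v → (v ∈ W₁ × v ∈ W₂) ⇔ VP G p v) (W₁∪W₂⊆N[P] : ∀ v → v ∈ W₁ ⊎ v ∈ W₂ → NP G p v)
  (chordal₁ : ChordalOn G W₁) (chordal₂ : ChordalOn G W₂)
  (common⊆W₁∪W₂ : ∀ v → Adj G (p fzero) v → Adj G (p (fromℕ m)) v → v ∈ W₁ ⊎ v ∈ W₂) where

  open FlatPath G p flat
  open Reversed G p flat using (p⁻; reverse-isFlatPath; InA⁻⇔InB; InB⁻⇔InA)

  A-neighbour-unique : ∀ {a a′ b} → InB b → InA a → InA a′ → Adj G a b → Adj G a′ b → a ≡ a′
  A-neighbour-unique = NoSectorWheel.A-neighbour-unique G ¬wheel p flat ¬even-hole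

  B-neighbour-unique : ∀ {b b′ a} → InA a → InB b → InB b′ → Adj G a b → Adj G a b′ → b ≡ b′
  B-neighbour-unique a∈A b∈B b′∈B ab ab′ =
    NoSectorWheel.A-neighbour-unique G ¬wheel p⁻ reverse-isFlatPath ¬even-hole
      (from InB⁻⇔InA a∈A) (from InA⁻⇔InB b∈B) (from InA⁻⇔InB b′∈B) (Adj-sym G ab) (Adj-sym G ab′)

  P⊆W₁ : ∀ {v} → VP G p v → v ∈ W₁
  P⊆W₁ v∈P = proj₁ (from (W₁∩W₂ _) v∈P)

  P⊆W₂ : ∀ {v} → VP G p v → v ∈ W₂
  P⊆W₂ v∈P = proj₂ (from (W₁∩W₂ _) v∈P)

  Unassigned : Fin n → Set
  Unassigned v = v ∉ W₁ × v ∉ W₂ × NP G p v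

  Unassigned? : Decidable Unassigned
  Unassigned? v = ¬? (v ∈? W₁) ×-dec (¬? (v ∈? W₂) ×-dec (VP? v ⊎-dec any? λ i → Adj? G (p i) v))

  unassigned⇒A⊎B : ∀ {v} → Unassigned v → InA v ⊎ InB v
  unassigned⇒A⊎B {v} (v∉W₁ , v∉W₂ , v∈N[P]) with NP∖VP⇒end-adjacent v∈N[P] (v∉W₁ ∘ P⊆W₁)
  ... | inj₁ p₁-v with Adj? G pₖ v
  ...   | yes pₖ-v = ⊥-elim ([ v∉W₁ , v∉W₂ ] (common⊆W₁∪W₂ v p₁-v pₖ-v))
  ...   | no ¬pₖ-v = inj₁ (p₁-v , ¬pₖ-v , v∉W₁ ∘ P⊆W₁)
  unassigned⇒A⊎B {v} (v∉W₁ , v∉W₂ , v∈N[P]) | inj₂ pₖ-v with Adj? G p₁ v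
  ...   | yes p₁-v = ⊥-elim ([ v∉W₁ , v∉W₂ ] (common⊆W₁∪W₂ v p₁-v pₖ-v))
  ...   | no ¬p₁-v = inj₂ (pₖ-v , ¬p₁-v , v∉W₁ ∘ P⊆W₁)

  JoinsW₁ : Fin n → Set
  JoinsW₁ v = (InA v × ¬ (∃ λ b → b ∈ W₁ × Adj G v b × InB b))
            ⊎ (InB v × ∃ λ a → a ∈ W₂ × Adj G v a × InA a)

  JoinsW₁? : Decidable JoinsW₁
  JoinsW₁? v = (InA? v ×-dec ¬? (any? λ b → (b ∈? W₁) ×-dec (Adj? G v b ×-dec InB? b)))
          ⊎-dec (InB? v ×-dec any? λ a → (a ∈? W₂) ×-dec (Adj? G v a ×-dec InA? a))

  In₁′ In₂′ : Fin n → Set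
  In₁′ v = v ∈ W₁ ⊎ (Unassigned v × JoinsW₁ v)
  In₂′ v = v ∈ W₂ ⊎ (Unassigned v × ¬ JoinsW₁ v)

  In₁′? : Decidable In₁′
  In₁′? v = (v ∈? W₁) ⊎-dec (Unassigned? v ×-dec JoinsW₁? v)

  In₂′? : Decidable In₂′
  In₂′? v = (v ∈? W₂) ⊎-dec (Unassigned? v ×-dec ¬? (JoinsW₁? v))

  W₁′ W₂′ : Subset n
  W₁′ = subsetOf In₁′?
  W₂′ = subsetOf In₂′?

  W₁⊆W₁′ : W₁ ⊆ W₁′
  W₁⊆W₁′ = ∈-subsetOf⁺ In₁′? ∘ inj₁

  W₂⊆W₂′ : W₂ ⊆ W₂′
  W₂⊆W₂′ = ∈-subsetOf⁺ In₂′? ∘ inj₁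

  W₁′∩W₂′ : ∀ v → (v ∈ W₁′ × v ∈ W₂′) ⇔ VP G p v
  W₁′∩W₂′ v = mk⇔ (λ (v∈₁ , v∈₂) → both (∈-subsetOf⁻ In₁′? v∈₁) (∈-subsetOf⁻ In₂′? v∈₂))
                  (λ v∈P → W₁⊆W₁′ (P⊆W₁ v∈P) , W₂⊆W₂′ (P⊆W₂ v∈P))
    where
    both : In₁′ v → In₂′ v → VP G p v
    both (inj₁ v∈W₁)                 (inj₁ v∈W₂)                 = to (W₁∩W₂ v) (v∈W₁ , v∈W₂)
    both (inj₁ v∈W₁)                 (inj₂ ((v∉W₁ , _) , _))     = ⊥-elim (v∉W₁ v∈W₁)
    both (inj₂ ((_ , v∉W₂ , _) , _)) (inj₁ v∈W₂)                 = ⊥-elim (v∉W₂ v∈W₂)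
    both (inj₂ (_ , joins))          (inj₂ (_ , ¬joins))         = ⊥-elim (¬joins joins)

  W₁′⊆N[P] : ∀ {v} → v ∈ W₁′ → NP G p v
  W₁′⊆N[P] {v} v∈ with ∈-subsetOf⁻ In₁′? v∈
  ... | inj₁ v∈W₁                = W₁∪W₂⊆N[P] v (inj₁ v∈W₁)
  ... | inj₂ ((_ , _ , v∈N) , _) = v∈N

  W₂′⊆N[P] : ∀ {v} → v ∈ W₂′ → NP G p v
  W₂′⊆N[P] {v} v∈ with ∈-subsetOf⁻ In₂′? v∈
  ... | inj₁ v∈W₂                = W₁∪W₂⊆N[P] v (inj₂ v∈W₂)
  ... | inj₂ ((_ , _ , v∈N) , _) = v∈N

  W₁′∪W₂′ : ∀ v → (v ∈ W₁′ ⊎ v ∈ W₂′) ⇔ NP G p v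
  W₁′∪W₂′ v = mk⇔ [ W₁′⊆N[P] , W₂′⊆N[P] ] assign
    where
    assign : NP G p v → v ∈ W₁′ ⊎ v ∈ W₂′
    assign v∈N with v ∈? W₁ | v ∈? W₂ | JoinsW₁? v
    ... | yes v∈W₁ | _        | _          = inj₁ (W₁⊆W₁′ v∈W₁)
    ... | no  _    | yes v∈W₂ | _          = inj₂ (W₂⊆W₂′ v∈W₂)
    ... | no  v∉W₁ | no  v∉W₂ | yes joins  = inj₁ (∈-subsetOf⁺ In₁′? (inj₂ ((v∉W₁ , v∉W₂ , v∈N) , joins)))
    ... | no  v∉W₁ | no  v∉W₂ | no  ¬joins = inj₂ (∈-subsetOf⁺ In₂′? (inj₂ ((v∉W₁ , v∉W₂ , v∈N) , ¬joins)))

  W₁′∖W₁⊆A∪B : ∀ {v} → v ∈ W₁′ → v ∉ W₁ → InA v ⊎ InB v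
  W₁′∖W₁⊆A∪B v∈ v∉W₁ with ∈-subsetOf⁻ In₁′? v∈
  ... | inj₁ v∈W₁        = ⊥-elim (v∉W₁ v∈W₁)
  ... | inj₂ (unassigned , _) = unassigned⇒A⊎B unassigned

  W₂′∖W₂⊆A∪B : ∀ {v} → v ∈ W₂′ → v ∉ W₂ → InA v ⊎ InB v
  W₂′∖W₂⊆A∪B v∈ v∉W₂ with ∈-subsetOf⁻ In₂′? v∈
  ... | inj₁ v∈W₂        = ⊥-elim (v∉W₂ v∈W₂)
  ... | inj₂ (unassigned , _) = unassigned⇒A⊎B unassigned

  ¬A-B₁ : ∀ {a b} → a ∈ W₁′ → b ∈ W₁′ → InA a → InB b → ¬ Adj G a b
  ¬A-B₁ {a} {b} a∈ b∈ a∈A b∈B ab with ∈-subsetOf⁻ In₁′? a∈ | ∈-subsetOf⁻ In₁′? b∈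
  ... | _ | inj₂ (_ , inj₁ (b∈A , _)) = A∩B≡∅ b∈A b∈B
  ... | inj₂ (_ , inj₂ (a∈B , _)) | _ = A∩B≡∅ a∈A a∈B
  ... | inj₁ a∈W₁ | inj₁ b∈W₁ = chordal⇒¬A-B-edge chordal₁ P⊆W₁ a∈W₁ b∈W₁ a∈A b∈B ab
  ... | inj₂ (_ , inj₁ (_ , no-B-neighbour)) | inj₁ b∈W₁ = no-B-neighbour (b , b∈W₁ , ab , b∈B)
  ... | a-old-or-new | inj₂ (_ , inj₂ (_ , a′ , a′∈W₂ , ba′ , a′∈A))
    with A-neighbour-unique b∈B a∈A a′∈A ab (Adj-sym G ba′)
  ...   | refl with a-old-or-new
  ...     | inj₁ a∈W₁                  = proj₂ (proj₂ a∈A) (to (W₁∩W₂ a) (a∈W₁ , a′∈W₂))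
  ...     | inj₂ ((_ , a∉W₂ , _) , _)  = a∉W₂ a′∈W₂

  ¬A-B₂ : ∀ {a b} → a ∈ W₂′ → b ∈ W₂′ → InA a → InB b → ¬ Adj G a b
  ¬A-B₂ {a} {b} a∈ b∈ a∈A b∈B ab with ∈-subsetOf⁻ In₂′? a∈ | ∈-subsetOf⁻ In₂′? b∈
  ... | inj₁ a∈W₂ | inj₁ b∈W₂ = chordal⇒¬A-B-edge chordal₂ P⊆W₂ a∈W₂ b∈W₂ a∈A b∈B ab
  ... | inj₁ a∈W₂ | inj₂ (_ , b-stays) = b-stays (inj₂ (b∈B , a , a∈W₂ , Adj-sym G ab , a∈A))
  ... | inj₂ (_ , a-stays) | b-old-or-new
    with decidable-stable (any? λ b → (b ∈? W₁) ×-dec (Adj? G a b ×-dec InB? b)) (a-stays ∘ inj₁ ∘ (a∈A ,_))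
  ...   | b′ , b′∈W₁ , ab′ , b′∈B with B-neighbour-unique a∈A b∈B b′∈B ab ab′
  ...     | refl with b-old-or-new
  ...       | inj₁ b∈W₂                 = proj₂ (proj₂ b∈B) (to (W₁∩W₂ b) (b′∈W₁ , b∈W₂))
  ...       | inj₂ ((b∉W₁ , _) , _)     = b∉W₁ b′∈W₁

  chordal₁′ : ChordalOn G W₁′
  chordal₁′ = chordal-extension G ¬wheel p flat chordal₁ W₁′⊆N[P] W₁′∖W₁⊆A∪B ¬A-B₁

  chordal₂′ : ChordalOn G W₂′
  chordal₂′ = chordal-extension G ¬wheel p flat chordal₂ W₂′⊆N[P] W₂′∖W₂⊆A∪B ¬A-B₂

lemma3p6 : {n : ℕ} (G : Graph n) → ¬ EvenHole G → ¬ HasStarCutset G → ¬ HasSectorWheel G →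
    {m : ℕ} (p : Fin (suc m) → Fin n) → IsFlatPath G p →
    (W₁ W₂ : Subset n) →
    (∀ v → (v ∈ W₁ × v ∈ W₂) ⇔ VP G p v) →
    (∀ v → v ∈ W₁ ⊎ v ∈ W₂ → NP G p v) →
    ChordalOn G W₁ → ChordalOn G W₂ →
    (∀ v → Adj G (p fzero) v → Adj G (p (fromℕ m)) v → v ∈ W₁ ⊎ v ∈ W₂) →
    Σ (Subset n) λ W₁′ → Σ (Subset n) λ W₂′ →
      W₁ ⊆ W₁′ × W₂ ⊆ W₂′ ×
      (∀ v → (v ∈ W₁′ × v ∈ W₂′) ⇔ VP G p v) ×
      (∀ v → (v ∈ W₁′ ⊎ v ∈ W₂′) ⇔ NP G p v) ×
      ChordalOn G W₁′ × ChordalOn G W₂′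
lemma3p6 G ¬even-hole _ ¬wheel p flat W₁ W₂ W₁∩W₂ W₁∪W₂⊆N[P] chordal₁ chordal₂ common⊆W₁∪W₂ =
  W₁′ , W₂′ , W₁⊆W₁′ , W₂⊆W₂′ , W₁′∩W₂′ , W₁′∪W₂′ , chordal₁′ , chordal₂′
  where
  open Construction G ¬even-hole ¬wheel p flat W₁ W₂ W₁∩W₂ W₁∪W₂⊆N[P] chordal₁ chordal₂ common⊆W₁∪W₂
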